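{- Let $q$ be a prime power and $m$ a positive integer. For $\sigma\in\mathbb{S}_m$ let $E^\star_\sigma$ be the set of vectors $\bm{x}\in\mathbb{F}_q^{m\times 1}$ whose $m$ entries are nonzero and pairwise distinct and such that $\bm{\sigma}\bm{x} = \lambda\bm{x}$ for some $\lambda\in\mathbb{F}_q^*$. Then \[ \sum_{\sigma \in \mathbb{S}_m} |E_\sigma^\star| = m! \sum_{d \mid \gcd(q - 1, m)} \varphi(d) \binom{(q-1)/d}{m/d}. \]
   Context: $\mathbb{F}_q$ is the finite field with $q$ elements and $\mathbb{F}_q^*$ its multiplicative group. $\mathbb{S}_m$ is the symmetric group on $\{1,\dots,m\}$; for $\sigma\in\mathbb{S}_m$, $\bm{\sigma}$ is the $m\times m$ permutation matrix with $(i,j)$ entry $\delta_{\sigma(i),j}$. $\varphi$ is Euler's totient function; the sum is over positive divisors $d$ of $\gcd(q-1,m)$; binomial coefficients $\binom{a}{b}$ with $b>a$ are $0$. -}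

module Defs where

open import Level using (0ℓ)
open import Data.Nat as ℕ using (ℕ; zero; suc; _∸_; _/_; NonZero)
open import Data.Nat.Base using (_!)
open import Data.Nat.Divisibility using (_∣_; _∣?_)
open import Data.Nat.Coprimality using (Coprime; coprime?)
open import Data.Nat.GCD using (gcd)
open import Data.Nat.Combinatorics using (_C_)
open import Data.Fin using (Fin)
open import Data.Vec using (Vec; []; _∷_; lookup)
open import Data.List using (List; []; _∷_; map; concatMap; allFin; upTo; filter; length)
open import Data.Nat.ListAction using (sum)
open import Data.Product using (Σ; ∃; _×_; _,_)
open import Function.Bundles using (_↔_)
open import Relation.Nullary using (¬_)
open import Function.Definitions using (Injective)
open import Relation.Binary.PropositionalEquality using (_≡_; _≢_)
open import Algebra.Structures using (IsCommutativeRing)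

record FiniteField (q : ℕ) : Set₁ where
  infixl 7 _*_
  infixl 6 _+_
  field
    Carrier : Set
    _+_ _*_ : Carrier → Carrier → Carrier
    -_      : Carrier → Carrier
    0# 1#   : Carrier
    isCommutativeRing : IsCommutativeRing _≡_ _+_ _*_ -_ 0# 1#
    0≢1     : 0# ≢ 1#
    inverse : ∀ x → x ≢ 0# → ∃ λ y → x * y ≡ 1#
    enum    : Fin q ↔ Carrier

-- Counting the elements of a list satisfying a predicate
-- (relational, no decidability needed): CountIn P xs n  means
-- exactly n entries of xs (with multiplicity) satisfy P.

data CountIn {A : Set} (P : A → Set) : List A → ℕ → Set where
  c[]  : CountIn P [] 0
  cyes : ∀ {x xs n} → P x → CountIn P xs n → CountIn P (x ∷ xs) (suc n)
  cno  : ∀ {x xs n} → ¬ P x → CountIn P xs n → CountIn P (x ∷ xs) n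

allVecs : {A : Set} → List A → (m : ℕ) → List (Vec A m)
allVecs xs zero    = [] ∷ []
allVecs xs (suc m) = concatMap (λ x → map (x ∷_) (allVecs xs m)) xs

cartesian : {A B : Set} → List A → List B → List (A × B)
cartesian xs ys = concatMap (λ x → map (x ,_) ys) xs

-- Permutations of {1..m}: represented as the vector (σ(1),…,σ(m)),
-- required to be injective (equivalently bijective, as Fin m is finite).

IsPerm : {m : ℕ} → Vec (Fin m) m → Set
IsPerm σ = Injective _≡_ _≡_ (lookup σ)

-- List of all vectors in Fin m ^ m (each exactly once); S_m is the
-- sublist of those satisfying IsPerm.
allMaps : (m : ℕ) → List (Vec (Fin m) m)
allMaps m = allVecs (allFin m) m

module _ {q : ℕ} (F : FiniteField q) where
  open FiniteField F
  open import Function.Bundles using (Inverse)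

  elems : List Carrier
  elems = map (Inverse.to enum) (allFin q)

  -- (𝛔 x)_i = Σ_j δ_{σ(i),j} x_j = x_{σ(i)}
  permAct : {m : ℕ} → Vec (Fin m) m → Vec Carrier m → Fin m → Carrier
  permAct σ x i = lookup x (lookup σ i)

  InEstar : {m : ℕ} → Vec (Fin m) m → Vec Carrier m → Set
  InEstar {m} σ x =
      (∀ i → lookup x i ≢ 0#)
    × Injective _≡_ _≡_ (lookup x)
    × Σ Carrier (λ λ′ → λ′ ≢ 0# × (∀ i → permAct σ x i ≡ λ′ * lookup x i))

  -- (σ , x) with σ ∈ S_m and x ∈ E*_σ ;  Σ_σ |E*_σ| = number of such pairs
  PairInEstar : {m : ℕ} → Vec (Fin m) m × Vec Carrier m → Set
  PairInEstar (σ , x) = IsPerm σ × InEstar σ x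

  allPairs : (m : ℕ) → List (Vec (Fin m) m × Vec Carrier m)
  allPairs m = cartesian (allMaps m) (allVecs elems m)

φ : ℕ → ℕ
φ d = length (filter (λ k → coprime? k d) (map suc (upTo d)))

sumDivisors : ℕ → ((d : ℕ) → .{{_ : NonZero d}} → ℕ) → ℕ
sumDivisors g f = sum (map (λ k → f (suc k)) (filter (λ k → suc k ∣? g) (upTo g)))

rhs : ℕ → ℕ → ℕ
rhs q m = (m !) ℕ.* sumDivisors (gcd (q ∸ 1) m) (λ d → φ d ℕ.* (((q ∸ 1) / d) C (m / d)))

{-# OPTIONS --safe #-}
-- Write n = q - 1 and fix a generator g of the cyclic group F*. It exists because if some y
-- has order d, then its d powers are all the roots of x^d - 1, so at most φ(d) elements have
-- order d; as these numbers add up to n = Σ_{d ∣ n} φ(d), every d ∣ n (in particular d = n)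
-- occurs. Taking discrete logarithms, x ∈ E*_σ with eigenvalue g^k becomes an injective
-- exponent vector v : Fin m → ℤ/n with v ∘ σ = v + k.
-- Since v is injective, σ is determined by (k , v), and it exists exactly when the set of
-- entries of v is closed under +k, i.e. under +N with N = gcd(k, n). Such a set is a union
-- of residue classes mod N, each of size d = n/N: there are C(N, m/d) choices when d ∣ m
-- and none otherwise, each listed in m! orders. Summing over k, grouped by the reduced
-- fraction k/n with denominator d (φ(d) values of k), gives the right-hand side.
module Submission where
open import Defs
open import Data.Nat using (ℕ; zero; suc; _≥_)
open import Data.Fin using (Fin; zero; suc)
open import Data.List using (allFin)
open import Data.Empty using (⊥-elim)
open import Function.Bundles using (Inverse)
open import Function.Properties.Inverse using (↔-sym)
open import Relation.Nullary using (¬_)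
open import Relation.Binary.PropositionalEquality

module Cardinality where

  open import Data.Nat using (ℕ; zero; suc; _+_; _*_; _≤_)
  open import Data.Fin using (Fin; zero; suc)
  open import Data.Fin.Properties using (+↔⊎; 0↔⊥; cantor-schröder-bernstein; injective⇒≤)
  open import Data.Empty using (⊥; ⊥-elim)
  open import Data.Unit using (⊤; tt)
  open import Data.Bool using (Bool; true; false; T; if_then_else_)
  open import Data.Bool.Properties using (T-irrelevant)
  open import Data.Sum using (_⊎_; inj₁; inj₂)
  open import Data.Product using (Σ; _,_; proj₁; proj₂)
  open import Data.List using (List; map)
  open import Data.Nat.ListAction using (sum)
  open import Function using (_∘_)
  open import Function.Bundles using (Inverse; Injection; _↔_; mk↔ₛ′)
  open import Function.Properties.Inverse using (↔-sym; ↔-trans; ↔-refl; ↔⇒↣)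
  open import Data.Sum.Function.Propositional using (_⊎-↔_)
  open import Data.Product.Function.Dependent.Propositional using (Σ-↔)
  open import Relation.Binary.PropositionalEquality

  Card : Set → ℕ → Set
  Card A k = Fin k ↔ A

  -- Subtypes are cut out by Boolean predicates, so that membership proofs are irrelevant (Sub-≡).
  Sub : (A : Set) → (A → Bool) → Set
  Sub A b = Σ A (λ a → T (b a))

  sumFin : (k : ℕ) → (Fin k → ℕ) → ℕ
  sumFin zero c = 0
  sumFin (suc k) c = c zero + sumFin k (c ∘ suc)

  Inverse-to-injective : ∀ {A B : Set} (e : A ↔ B) {x y} → Inverse.to e x ≡ Inverse.to e y → x ≡ y
  Inverse-to-injective e = Injection.injective (↔⇒↣ e)

  card-unique : ∀ {A a b} → Card A a → Card A b → a ≡ b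
  card-unique {A} {a} {b} e f = cantor-schröder-bernstein {f = g} {g = h} ginj hinj
    where
    g : Fin a → Fin b
    g = Inverse.from f ∘ Inverse.to e
    h : Fin b → Fin a
    h = Inverse.from e ∘ Inverse.to f
    ginj : ∀ {x y} → g x ≡ g y → x ≡ y
    ginj = Inverse-to-injective e ∘ Inverse-to-injective (↔-sym f)
    hinj : ∀ {x y} → h x ≡ h y → x ≡ y
    hinj = Inverse-to-injective f ∘ Inverse-to-injective (↔-sym e)

  card-resp : ∀ {A B k} → A ↔ B → Card A k → Card B k
  card-resp e c = ↔-trans c e

  card-⊥ : Card ⊥ 0
  card-⊥ = 0↔⊥

  card-⊤ : Card ⊤ 1
  card-⊤ = mk↔ₛ′ (λ _ → tt) (λ _ → zero) (λ _ → refl) (λ { zero → refl })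

  card-⊎ : ∀ {A B a b} → Card A a → Card B b → Card (A ⊎ B) (a + b)
  card-⊎ ca cb = ↔-trans +↔⊎ (ca ⊎-↔ cb)

  card-T : ∀ b → Card (T b) (if b then 1 else 0)
  card-T true = card-⊤
  card-T false = card-⊥

  Σ-suc : ∀ {k} (B : Fin (suc k) → Set) → Σ (Fin (suc k)) B ↔ (B zero ⊎ Σ (Fin k) (B ∘ suc))
  Σ-suc B = mk↔ₛ′ f g fg gf
    where
    f : Σ (Fin _) B → (B zero ⊎ Σ (Fin _) (B ∘ suc))
    f (zero , b) = inj₁ b
    f (suc i , b) = inj₂ (i , b)
    g : (B zero ⊎ Σ (Fin _) (B ∘ suc)) → Σ (Fin _) B
    g (inj₁ b) = zero , b
    g (inj₂ (i , b)) = suc i , b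
    fg : ∀ x → f (g x) ≡ x
    fg (inj₁ _) = refl
    fg (inj₂ _) = refl
    gf : ∀ x → g (f x) ≡ x
    gf (zero , _) = refl
    gf (suc _ , _) = refl

  card-ΣFin : ∀ k (B : Fin k → Set) (c : Fin k → ℕ) → (∀ i → Card (B i) (c i)) → Card (Σ (Fin k) B) (sumFin k c)
  card-ΣFin zero B c h = ↔-trans 0↔⊥ (mk↔ₛ′ ⊥-elim (λ { (() , _) }) (λ { (() , _) }) λ ())
  card-ΣFin (suc k) B c h = card-resp (↔-sym (Σ-suc B)) (card-⊎ (h zero) (card-ΣFin k (B ∘ suc) (c ∘ suc) (h ∘ suc)))

  card-Σ : ∀ {A k} (e : Card A k) (B : A → Set) (c : A → ℕ) → (∀ a → Card (B a) (c a)) →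
           Card (Σ A B) (sumFin k (c ∘ Inverse.to e))
  card-Σ {A} {k} e B c h = card-resp (Σ-↔ e ↔-refl) (card-ΣFin k (B ∘ Inverse.to e) (c ∘ Inverse.to e) (h ∘ Inverse.to e))

  card-injection-≤ : ∀ {A B a b} → Card A a → Card B b → (f : A → B) → (∀ {x y} → f x ≡ f y → x ≡ y) → a ≤ b
  card-injection-≤ {a = a} {b} ca cb f finj = injective⇒≤ {f = g} ginj
    where
    g : Fin a → Fin b
    g = Inverse.from cb ∘ f ∘ Inverse.to ca
    ginj : ∀ {x y} → g x ≡ g y → x ≡ y
    ginj = Inverse-to-injective ca ∘ finj ∘ Inverse-to-injective (↔-sym cb)

  -- xs lists every element of A exactly once, phrased directly as a counting principle.
  Enumerates : (A : Set) → List A → Set₁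
  Enumerates A xs = ∀ (B : A → Set) (c : A → ℕ) → (∀ a → Card (B a) (c a)) → Card (Σ A B) (sum (map c xs))

  Sub-≡ : ∀ {A : Set} {b : A → Bool} {a a' : A} {t : T (b a)} {t' : T (b a')} → a ≡ a' → _≡_ {A = Sub A b} (a , t) (a' , t')
  Sub-≡ {b = b} {a} {t = t} {t'} refl = cong (a ,_) (T-irrelevant t t')

  Sub-↔-mk : ∀ {A A' : Set} (b : A → Bool) (b' : A' → Bool)
    (f : Sub A b → A') (g : Sub A' b' → A)
    (pf : ∀ s → T (b' (f s))) (pg : ∀ s → T (b (g s))) →
    (∀ s → f (g s , pg s) ≡ proj₁ s) → (∀ s → g (f s , pf s) ≡ proj₁ s) →
    Sub A b ↔ Sub A' b'
  Sub-↔-mk b b' f g pf pg fg gf = mk↔ₛ′ (λ s → f s , pf s) (λ s → g s , pg s)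
    (λ s → Sub-≡ (fg s)) (λ s → Sub-≡ (gf s))

  Sub-↔ : ∀ {A A' : Set} (e : A ↔ A') (b : A → Bool) (b' : A' → Bool) →
    (∀ a → b' (Inverse.to e a) ≡ b a) → Sub A b ↔ Sub A' b'
  Sub-↔ e b b' h = Sub-↔-mk b b' (λ s → Inverse.to e (proj₁ s)) (λ s → Inverse.from e (proj₁ s))
    (λ s → subst T (sym (h (proj₁ s))) (proj₂ s))
    (λ s → subst T (trans (sym (cong b' (Inverse.strictlyInverseˡ e (proj₁ s)))) (h _)) (proj₂ s))
    (λ s → Inverse.strictlyInverseˡ e (proj₁ s)) (λ s → Inverse.strictlyInverseʳ e (proj₁ s))

  Sub-cong : ∀ {A : Set} (b b' : A → Bool) → (∀ a → b a ≡ b' a) → Sub A b ↔ Sub A b'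
  Sub-cong b b' h = Sub-↔ ↔-refl b b' (λ a → sym (h a))

  sumFin-const : ∀ k c → sumFin k (λ _ → c) ≡ k * c
  sumFin-const zero c = refl
  sumFin-const (suc k) c = cong (c +_) (sumFin-const k c)

  sumFin-cong : ∀ k (f g : Fin k → ℕ) → (∀ i → f i ≡ g i) → sumFin k f ≡ sumFin k g
  sumFin-cong zero f g h = refl
  sumFin-cong (suc k) f g h = cong₂ _+_ (h zero) (sumFin-cong k (f ∘ suc) (g ∘ suc) (h ∘ suc))

  card-empty : ∀ {A : Set} → (A → ⊥) → Card A 0
  card-empty ¬a = mk↔ₛ′ (λ ()) (λ a → ⊥-elim (¬a a)) (λ a → ⊥-elim (¬a a)) (λ ())

  card-inhabited : ∀ {A : Set} {k} → Card A (suc k) → A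
  card-inhabited e = Inverse.to e zero


module Enumeration where

  open Cardinality
  open import Defs using (CountIn; c[]; cyes; cno; allVecs; cartesian)
  open import Data.Nat using (ℕ; zero; suc; _+_)
  open import Data.Nat.Properties using (+-identityʳ)
  open import Data.Fin using (Fin; zero; suc)
  open import Data.Bool using (T; if_then_else_)
  open import Data.Product using (Σ; _×_; _,_; proj₁; proj₂)
  open import Data.Vec using (Vec; []; _∷_)
  open import Data.List using (List; []; _∷_; map; concatMap; _++_; allFin; tabulate)
  open import Data.List.Properties using (map-++; map-∘)
  open import Data.Nat.ListAction using (sum)
  open import Data.Nat.ListAction.Properties using (sum-++)
  open import Function using (_∘_; id)
  open import Function.Bundles using (Inverse; _↔_; mk↔ₛ′)
  open import Function.Properties.Inverse using (↔-sym; ↔-refl)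
  open import Data.Product.Function.Dependent.Propositional using (Σ-↔)
  open import Relation.Nullary using (Dec; yes; no)
  open import Relation.Nullary.Decidable using (⌊_⌋)
  open import Relation.Binary.PropositionalEquality

  sum-tab : ∀ k (f : Fin k → ℕ) → sum (tabulate f) ≡ sumFin k f
  sum-tab zero f = refl
  sum-tab (suc k) f = cong (f zero +_) (sum-tab k (f ∘ suc))

  map-tab : ∀ {A B : Set} k (c : A → B) (f : Fin k → A) → map c (tabulate f) ≡ tabulate (c ∘ f)
  map-tab zero c f = refl
  map-tab (suc k) c f = cong (c (f zero) ∷_) (map-tab k c (f ∘ suc))

  enum-allFin : ∀ k → Enumerates (Fin k) (allFin k)
  enum-allFin k B c h = subst (Card _) (sym (trans (cong sum (map-tab k c id)) (sum-tab k c))) (card-ΣFin k B c h)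

  sum-map-∘ : ∀ {A B : Set} (c : B → ℕ) (f : A → B) xs → sum (map c (map f xs)) ≡ sum (map (c ∘ f) xs)
  sum-map-∘ c f xs = cong sum (sym (map-∘ xs))

  enum-map : ∀ {A A' : Set} {xs} → Enumerates A xs → (e : A ↔ A') → Enumerates A' (map (Inverse.to e) xs)
  enum-map {xs = xs} en e B c h =
    subst (Card _) (sym (sum-map-∘ c (Inverse.to e) xs))
      (card-resp (Σ-↔ e ↔-refl) (en (B ∘ Inverse.to e) (c ∘ Inverse.to e) (h ∘ Inverse.to e)))

  sum-concatMap : ∀ {A B : Set} (c : B → ℕ) (f : A → List B) xs →
    sum (map c (concatMap f xs)) ≡ sum (map (λ a → sum (map c (f a))) xs)
  sum-concatMap c f [] = refl
  sum-concatMap c f (x ∷ xs) = begin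
      sum (map c (f x ++ concatMap f xs))
    ≡⟨ cong sum (map-++ c (f x) (concatMap f xs)) ⟩
      sum (map c (f x) ++ map c (concatMap f xs))
    ≡⟨ sum-++ (map c (f x)) _ ⟩
      sum (map c (f x)) + sum (map c (concatMap f xs))
    ≡⟨ cong (sum (map c (f x)) +_) (sum-concatMap c f xs) ⟩
      _ ∎
    where open ≡-Reasoning

  sum-map-cong : ∀ {A : Set} (f g : A → ℕ) xs → (∀ a → f a ≡ g a) → sum (map f xs) ≡ sum (map g xs)
  sum-map-cong f g [] h = refl
  sum-map-cong f g (x ∷ xs) h = cong₂ _+_ (h x) (sum-map-cong f g xs h)

  Σ-assoc : ∀ {A C : Set} {D : A → C → Set} →
    Σ (A × C) (λ p → D (proj₁ p) (proj₂ p)) ↔ Σ A (λ a → Σ C (D a))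
  Σ-assoc = mk↔ₛ′ (λ { ((a , c) , d) → a , c , d }) (λ { (a , c , d) → (a , c) , d }) (λ _ → refl) (λ _ → refl)

  enum-cart : ∀ {A C : Set} {xs ys} → Enumerates A xs → Enumerates C ys → Enumerates (A × C) (cartesian xs ys)
  enum-cart {A} {C} {xs} {ys} ex ey B c h =
    subst (Card _) (sym eq)
      (card-resp (↔-sym (Σ-assoc {D = λ a c → B (a , c)}))
        (ex (λ a → Σ C (λ x → B (a , x))) (λ a → sum (map (λ x → c (a , x)) ys))
          (λ a → ey (λ x → B (a , x)) (λ x → c (a , x)) (λ x → h (a , x)))))
    where
    eq : sum (map c (cartesian xs ys)) ≡ sum (map (λ a → sum (map (λ x → c (a , x)) ys)) xs)
    eq = trans (sum-concatMap c (λ a → map (a ,_) ys) xs)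
               (sum-map-cong _ _ xs (λ a → sum-map-∘ c (a ,_) ys))

  Vec-split : ∀ {A : Set} {m} {B : Vec A (suc m) → Set} →
    Σ (Vec A (suc m)) B ↔ Σ A (λ a → Σ (Vec A m) (λ v → B (a ∷ v)))
  Vec-split = mk↔ₛ′ (λ { (a ∷ v , b) → a , v , b }) (λ { (a , v , b) → a ∷ v , b }) (λ _ → refl) (λ { (_ ∷ _ , _) → refl })

  Vec-zero : ∀ {A : Set} {B : Vec A 0 → Set} → Σ (Vec A 0) B ↔ B []
  Vec-zero = mk↔ₛ′ (λ { ([] , b) → b }) (λ b → [] , b) (λ _ → refl) (λ { ([] , _) → refl })

  enum-allVecs : ∀ {A : Set} {xs} → Enumerates A xs → ∀ m → Enumerates (Vec A m) (allVecs xs m)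
  enum-allVecs ex zero B c h = subst (Card _) (sym (+-identityʳ (c []))) (card-resp (↔-sym Vec-zero) (h []))
  enum-allVecs {A} {xs} ex (suc m) B c h =
    subst (Card _) (sym eq)
      (card-resp (↔-sym Vec-split)
        (ex (λ a → Σ (Vec A m) (λ v → B (a ∷ v))) (λ a → sum (map (λ v → c (a ∷ v)) (allVecs xs m)))
          (λ a → enum-allVecs ex m (λ v → B (a ∷ v)) (λ v → c (a ∷ v)) (λ v → h (a ∷ v)))))
    where
    eq : sum (map c (allVecs xs (suc m))) ≡ sum (map (λ a → sum (map (λ v → c (a ∷ v)) (allVecs xs m))) xs)
    eq = trans (sum-concatMap c (λ a → map (a ∷_) (allVecs xs m)) xs)
               (sum-map-cong _ _ xs (λ a → sum-map-∘ c (a ∷_) (allVecs xs m)))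

  indicator : ∀ {P : Set} → Dec P → ℕ
  indicator d = if ⌊ d ⌋ then 1 else 0

  countIn-indicators : ∀ {A : Set} {P : A → Set} (P? : ∀ a → Dec (P a)) xs →
    CountIn P xs (sum (map (λ a → indicator (P? a)) xs))
  countIn-indicators P? [] = c[]
  countIn-indicators P? (x ∷ xs) with P? x
  ... | yes p = cyes p (countIn-indicators P? xs)
  ... | no ¬p = cno ¬p (countIn-indicators P? xs)

  countIn-card : ∀ {A : Set} {P : A → Set} (P? : ∀ a → Dec (P a)) xs → Enumerates A xs → ∀ {n} →
    Card (Sub A (λ a → ⌊ P? a ⌋)) n → CountIn P xs n
  countIn-card {A} P? xs ex {n} cn =
    subst (CountIn _ xs) (card-unique (ex (λ a → T ⌊ P? a ⌋) (λ a → indicator (P? a)) (λ a → card-T ⌊ P? a ⌋)) cn)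
      (countIn-indicators P? xs)


module DistinctVectors where

  open Cardinality
  open import Data.Nat using (ℕ; zero; suc; _*_; _!)
  open import Data.Nat.Properties using (1+n≰n)
  open import Data.Fin using (Fin; zero; suc; punchIn; punchOut)
  open import Data.Fin.Properties using (punchIn-injective; punchInᵢ≢i; punchOut-cong; punchOut-injective;
    punchIn-punchOut; punchOut-punchIn; injective⇒≤; any?) renaming (_≟_ to _≟F_)
  open import Data.Empty using (⊥-elim)
  open import Data.Unit using (tt)
  open import Data.Bool using (Bool; true; false; T; not; _∧_; _∨_)
  open import Data.Product using (Σ; ∃; _×_; _,_; proj₁; proj₂)
  open import Data.Vec using (Vec; []; _∷_; lookup; map)
  open import Data.Vec.Properties using (map-∘; map-id; map-cong)
  open import Function using (_∘_)
  open import Function.Bundles using (Inverse; _↔_; mk↔ₛ′)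
  open import Function.Properties.Inverse using (↔-sym)
  open import Relation.Nullary using (Dec; yes; no; ¬_)
  open import Relation.Nullary.Decidable using (⌊_⌋)
  open import Relation.Binary.Definitions using (DecidableEquality)
  open import Relation.Binary.PropositionalEquality

  T∧ : ∀ {a b} → T (a ∧ b) → T a × T b
  T∧ {true} {true} t = tt , tt

  ∧T : ∀ {a b} → T a → T b → T (a ∧ b)
  ∧T {true} {true} _ _ = tt

  Tnot∨ : ∀ {a b} → T (not (a ∨ b)) → T (not a) × T (not b)
  Tnot∨ {false} {false} t = tt , tt

  ∨T₁ : ∀ {a b} → T a → T (a ∨ b)
  ∨T₁ {true} _ = tt

  ∨T₂ : ∀ {a b} → T b → T (a ∨ b)
  ∨T₂ {true} _ = tt
  ∨T₂ {false} t = t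

  notT : ∀ {a} → ¬ T a → T (not a)
  notT {false} _ = tt
  notT {true} h = h tt

  Tnot : ∀ {a} → T (not a) → ¬ T a
  Tnot {false} _ ()

  T-dec : ∀ {P : Set} (d : Dec P) → T ⌊ d ⌋ → P
  T-dec (yes p) _ = p

  dec-T : ∀ {P : Set} (d : Dec P) → P → T ⌊ d ⌋
  dec-T (yes p) _ = tt
  dec-T (no ¬p) p = ¬p p

  Tnot-dec : ∀ {P : Set} (d : Dec P) → T (not ⌊ d ⌋) → ¬ P
  Tnot-dec (no ¬p) _ = ¬p

  dec-Tnot : ∀ {P : Set} (d : Dec P) → ¬ P → T (not ⌊ d ⌋)
  dec-Tnot (no _) _ = tt
  dec-Tnot (yes p) ¬p = ¬p p

  injective⇒surjective : ∀ {m} (f : Fin m → Fin m) → (∀ {x y} → f x ≡ f y → x ≡ y) → ∀ y → ∃ λ x → f x ≡ y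
  injective⇒surjective {zero} f inj ()
  injective⇒surjective {suc m} f inj y with any? (λ x → f x ≟F y)
  ... | yes p = p
  ... | no ¬p = ⊥-elim (1+n≰n (injective⇒≤ {f = g} ginj))
    where
    ne : ∀ x → y ≢ f x
    ne x eq = ¬p (x , sym eq)
    g : Fin (suc m) → Fin m
    g x = punchOut (ne x)
    ginj : ∀ {a b} → g a ≡ g b → a ≡ b
    ginj {a} {b} eq = inj (punchOut-injective (ne a) (ne b) eq)

  module VecMembership {A : Set} (_≟_ : DecidableEquality A) where

    member : ∀ {m} → A → Vec A m → Bool
    member a [] = false
    member a (x ∷ w) = ⌊ x ≟ a ⌋ ∨ member a w

    distinct : ∀ {m} → Vec A m → Bool
    distinct [] = true
    distinct (x ∷ w) = not (member x w) ∧ distinct w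

    member-sound : ∀ {m} a (w : Vec A m) → T (member a w) → ∃ λ i → lookup w i ≡ a
    member-sound a (x ∷ w) t with x ≟ a
    ... | yes p = zero , p
    ... | no _ with member-sound a w t
    ... | i , q = suc i , q

    member-complete : ∀ {m} a (w : Vec A m) i → lookup w i ≡ a → T (member a w)
    member-complete a (x ∷ w) zero p = ∨T₁ (dec-T (x ≟ a) p)
    member-complete a (x ∷ w) (suc i) p = ∨T₂ {⌊ x ≟ a ⌋} (member-complete a w i p)

    distinct⇒injective : ∀ {m} (w : Vec A m) → T (distinct w) → ∀ {i j} → lookup w i ≡ lookup w j → i ≡ j
    distinct⇒injective (x ∷ w) t {zero} {zero} eq = refl
    distinct⇒injective (x ∷ w) t {zero} {suc j} eq = ⊥-elim (Tnot (proj₁ (T∧ t)) (member-complete x w j (sym eq)))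
    distinct⇒injective (x ∷ w) t {suc i} {zero} eq = ⊥-elim (Tnot (proj₁ (T∧ t)) (member-complete x w i eq))
    distinct⇒injective (x ∷ w) t {suc i} {suc j} eq = cong suc (distinct⇒injective w (proj₂ (T∧ {not (member x w)} t)) eq)

    injective⇒distinct : ∀ {m} (w : Vec A m) → (∀ {i j} → lookup w i ≡ lookup w j → i ≡ j) → T (distinct w)
    injective⇒distinct [] h = tt
    injective⇒distinct (x ∷ w) h = ∧T (notT λ t → let (i , p) = member-sound x w t in 0≢s (h {zero} {suc i} (sym p)))
                            (injective⇒distinct w (λ eq → suc-inj (h eq)))
      where
      0≢s : ∀ {k} {i : Fin k} → ¬ (Fin.zero ≡ suc i)
      0≢s ()
      suc-inj : ∀ {k} {i j : Fin k} → Fin.suc i ≡ suc j → i ≡ j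
      suc-inj refl = refl

  module InjectiveMap {A B : Set} (_≟A_ : DecidableEquality A) (_≟B_ : DecidableEquality B)
    (f : A → B) (finj : ∀ {x y} → f x ≡ f y → x ≡ y) where
    module DA = VecMembership _≟A_
    module DB = VecMembership _≟B_

    dec-map : ∀ x a → ⌊ f x ≟B f a ⌋ ≡ ⌊ x ≟A a ⌋
    dec-map x a with f x ≟B f a | x ≟A a
    ... | yes p | yes q = refl
    ... | yes p | no ¬q = ⊥-elim (¬q (finj p))
    ... | no ¬p | yes q = ⊥-elim (¬p (cong f q))
    ... | no ¬p | no ¬q = refl

    member-map : ∀ {m} a (w : Vec A m) → DB.member (f a) (map f w) ≡ DA.member a w
    member-map a [] = refl
    member-map a (x ∷ w) = cong₂ _∨_ (dec-map x a) (member-map a w)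

    distinct-map : ∀ {m} (w : Vec A m) → DB.distinct (map f w) ≡ DA.distinct w
    distinct-map [] = refl
    distinct-map (x ∷ w) = cong₂ (λ a b → not a ∧ b) (member-map x w) (distinct-map w)

  fallingFactorial : ℕ → ℕ → ℕ
  fallingFactorial k zero = 1
  fallingFactorial zero (suc m) = 0
  fallingFactorial (suc k) (suc m) = suc k * fallingFactorial k m

  open VecMembership using (member; distinct)

  module _ {k : ℕ} where
    private
      mb : ∀ {m} → Fin (suc k) → Vec (Fin (suc k)) m → Bool
      mb = VecMembership.member (_≟F_ {suc k})
      ds : ∀ {m} → Vec (Fin (suc k)) m → Bool
      ds = VecMembership.distinct (_≟F_ {suc k})
      mb' : ∀ {m} → Fin k → Vec (Fin k) m → Bool
      mb' = VecMembership.member (_≟F_ {k})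
      ds' : ∀ {m} → Vec (Fin k) m → Bool
      ds' = VecMembership.distinct (_≟F_ {k})

    punchOutAll : ∀ {m} (a : Fin (suc k)) (w : Vec (Fin (suc k)) m) → T (not (mb a w)) → Vec (Fin k) m
    punchOutAll a [] _ = []
    punchOutAll a (x ∷ w) t = punchOut {i = a} {j = x} (λ eq → Tnot-dec (x ≟F a) (proj₁ (Tnot∨ t)) (sym eq))
                         ∷ punchOutAll a w (proj₂ (Tnot∨ {⌊ x ≟F a ⌋} t))

    punchIn-punchOutAll : ∀ {m} a (w : Vec (Fin (suc k)) m) t → map (punchIn a) (punchOutAll a w t) ≡ w
    punchIn-punchOutAll a [] t = refl
    punchIn-punchOutAll a (x ∷ w) t = cong₂ _∷_ (punchIn-punchOut _) (punchIn-punchOutAll a w _)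

    punchOutAll-punchIn : ∀ {m} a (w : Vec (Fin k) m) t → punchOutAll a (map (punchIn a) w) t ≡ w
    punchOutAll-punchIn a [] t = refl
    punchOutAll-punchIn a (x ∷ w) t = cong₂ _∷_ (trans (punchOut-cong a refl) (punchOut-punchIn a)) (punchOutAll-punchIn a w _)

    not-member-punchIn : ∀ {m} a (w : Vec (Fin k) m) → T (not (mb a (map (punchIn a) w)))
    not-member-punchIn a w = notT λ t → let (i , p) = VecMembership.member-sound _≟F_ a (map (punchIn a) w) t in
       punchInᵢ≢i a (lookup w i) (trans (sym (lookup-map' i w)) p)
      where
      lookup-map' : ∀ {m} (i : Fin m) (w : Vec (Fin k) m) → lookup (map (punchIn a) w) i ≡ punchIn a (lookup w i)
      lookup-map' zero (x ∷ w) = refl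
      lookup-map' (suc i) (x ∷ w) = lookup-map' i w

    distinct-punchIn : ∀ {m} a (w : Vec (Fin k) m) → ds (map (punchIn a) w) ≡ ds' w
    distinct-punchIn a w = InjectiveMap.distinct-map _≟F_ _≟F_ (punchIn a) (punchIn-injective a _ _) w

    distinct-head-split : ∀ {m} → Sub (Vec (Fin (suc k)) (suc m)) ds ↔ Σ (Fin (suc k)) (λ _ → Sub (Vec (Fin k) m) ds')
    distinct-head-split {m} = mk↔ₛ′ to from to-from from-to
      where
      to : Sub (Vec (Fin (suc k)) (suc m)) ds → Σ (Fin (suc k)) (λ _ → Sub (Vec (Fin k) m) ds')
      to (a ∷ w , t) = a , punchOutAll a w (proj₁ (T∧ t)) ,
         subst T (trans (cong ds (sym (punchIn-punchOutAll a w (proj₁ (T∧ t))))) (distinct-punchIn a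
             (punchOutAll a w (proj₁ (T∧ t))))) (proj₂ (T∧ {not (mb a w)} t))
      from : Σ (Fin (suc k)) (λ _ → Sub (Vec (Fin k) m) ds') → Sub (Vec (Fin (suc k)) (suc m)) ds
      from (a , w , t) = a ∷ map (punchIn a) w , ∧T (not-member-punchIn a w) (subst T (sym (distinct-punchIn a w)) t)
      to-from : ∀ s → to (from s) ≡ s
      to-from (a , w , t) = cong (a ,_) (Sub-≡ (punchOutAll-punchIn a w _))
      from-to : ∀ s → from (to s) ≡ s
      from-to (a ∷ w , t) = Sub-≡ (cong (a ∷_) (punchIn-punchOutAll a w _))

  card-distinct-Fin : ∀ k m → Card (Sub (Vec (Fin k) m) (distinct _≟F_)) (fallingFactorial k m)
  card-distinct-Fin k zero = mk↔ₛ′ (λ _ → [] , tt) (λ _ → zero) (λ { ([] , tt) → refl }) (λ { zero → refl ; (suc ()) })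
  card-distinct-Fin zero (suc m) = card-empty (λ { ((() ∷ _) , _) })
  card-distinct-Fin (suc k) (suc m) =
    card-resp (↔-sym distinct-head-split)
      (subst (Card _) (sumFin-const (suc k) (fallingFactorial k m)) (card-ΣFin (suc k) _ _ (λ _ → card-distinct-Fin k m)))

  vec-↔ : ∀ {A B : Set} {m} → A ↔ B → Vec A m ↔ Vec B m
  vec-↔ e = mk↔ₛ′ (map (Inverse.to e)) (map (Inverse.from e))
    (λ w → trans (sym (map-∘ _ _ w)) (trans (map-cong (Inverse.strictlyInverseˡ e) w) (map-id w)))
    (λ w → trans (sym (map-∘ _ _ w)) (trans (map-cong (Inverse.strictlyInverseʳ e) w) (map-id w)))

  card-distinct : ∀ {A : Set} (_≟_ : DecidableEquality A) {k} → Card A k → ∀ m → Card (Sub (Vec A m) (distinct _≟_)) (fallingFactorial k m)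
  card-distinct _≟_ {k} e m = card-resp (Sub-↔ (vec-↔ e) (distinct _≟F_) (distinct _≟_)
      (InjectiveMap.distinct-map _≟F_ _≟_ (Inverse.to e) (Inverse-to-injective e))) (card-distinct-Fin k m)

  fallingFactorial[n,n]≡n! : ∀ m → fallingFactorial m m ≡ m !
  fallingFactorial[n,n]≡n! zero = refl
  fallingFactorial[n,n]≡n! (suc m) = cong (suc m *_) (fallingFactorial[n,n]≡n! m)

  distinct-full : ∀ {A : Set} (_≟_ : DecidableEquality A) {m} → Card A m → (w : Vec A m) → T (distinct _≟_ w) →
    ∀ a → T (member _≟_ a w)
  distinct-full _≟_ {m} e w t a with injective⇒surjective f finj (Inverse.from e a)
    where
    f : Fin m → Fin m
    f = Inverse.from e ∘ lookup w
    finj : ∀ {x y} → f x ≡ f y → x ≡ y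
    finj = VecMembership.distinct⇒injective _≟_ w t ∘ Inverse-to-injective (↔-sym e)
  ... | x , p = VecMembership.member-complete _≟_ a w x (Inverse-to-injective (↔-sym e) p)


module Subsets where

  open Cardinality
  open import Data.Nat using (ℕ; zero; suc; _≡ᵇ_)
  open import Data.Fin using (zero; suc)
  open import Data.Nat.Combinatorics using (_C_; nCk+nC[k+1]≡[n+1]C[k+1])
  open import Data.Unit using (tt)
  open import Data.Sum using (_⊎_; inj₁; inj₂)
  open import Data.Bool using (Bool; true; false)
  open import Data.Product using (_,_)
  open import Data.Vec using (Vec; []; _∷_)
  open import Function using (_∘_)
  open import Function.Bundles using (Inverse; _↔_; mk↔ₛ′)
  open import Function.Properties.Inverse using (↔-sym)
  open import Relation.Binary.PropositionalEquality

  countTrue : ∀ {N} → Vec Bool N → ℕ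
  countTrue [] = 0
  countTrue (true ∷ t) = suc (countTrue t)
  countTrue (false ∷ t) = countTrue t

  nC0 : ∀ n → n C 0 ≡ 1
  nC0 zero = refl
  nC0 (suc n) = refl

  Vec-Bool-head-split : ∀ {N} (P : Vec Bool (suc N) → Bool) →
    Sub (Vec Bool (suc N)) P ↔ (Sub (Vec Bool N) (P ∘ (true ∷_)) ⊎ Sub (Vec Bool N) (P ∘ (false ∷_)))
  Vec-Bool-head-split P = mk↔ₛ′ to from tf ft
    where
    to : Sub _ P → _
    to (true ∷ t , p) = inj₁ (t , p)
    to (false ∷ t , p) = inj₂ (t , p)
    from : _ → Sub _ P
    from (inj₁ (t , p)) = true ∷ t , p
    from (inj₂ (t , p)) = false ∷ t , p
    tf : ∀ x → to (from x) ≡ x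
    tf (inj₁ _) = refl
    tf (inj₂ _) = refl
    ft : ∀ x → from (to x) ≡ x
    ft (true ∷ _ , _) = refl
    ft (false ∷ _ , _) = refl

  card-subsets : ∀ N j → Card (Sub (Vec Bool N) (λ t → countTrue t ≡ᵇ j)) (N C j)
  card-subsets zero zero = mk↔ₛ′ (λ _ → [] , tt) (λ _ → zero) (λ { ([] , tt) → refl }) (λ { zero → refl ; (suc ()) })
  card-subsets zero (suc j) = card-empty (λ { ([] , ()) })
  card-subsets (suc N) zero =
    card-resp (↔-sym (Vec-Bool-head-split (λ t → countTrue t ≡ᵇ 0)))
      (subst (Card _) (trans (nC0 N) (sym (nC0 (suc N)))) (card-⊎ (card-empty (λ { (_ , ()) })) (card-subsets N zero)))
  card-subsets (suc N) (suc j) =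
    card-resp (↔-sym (Vec-Bool-head-split (λ t → countTrue t ≡ᵇ suc j)))
      (subst (Card _) (nCk+nC[k+1]≡[n+1]C[k+1] N j) (card-⊎ (card-subsets N j) (card-subsets N (suc j))))


module FibreUnions where

  open Cardinality
  open DistinctVectors
  open Subsets
  open import Data.Nat using (ℕ; zero; suc; _*_; _≡ᵇ_; _!)
  open import Data.Nat.Properties using (≡ᵇ⇒≡; ≡⇒≡ᵇ; *-cancelʳ-≡)
  open import Data.Nat.Combinatorics using (_C_)
  open import Data.Fin using (Fin; zero; suc)
  open import Data.Fin.Properties using (all?; any?) renaming (_≟_ to _≟F_)
  open import Data.Empty using (⊥-elim)
  open import Data.Unit using (tt)
  open import Data.Bool using (Bool; true; false; T; _∧_)
  import Data.Bool.Properties as BP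
  open import Data.Product using (Σ; ∃; _,_; proj₁; proj₂)
  open import Data.Vec using (Vec; []; _∷_; lookup; map; tabulate)
  open import Data.Vec.Properties using (lookup-map; tabulate-∘; tabulate∘lookup; lookup∘tabulate; tabulate-cong; ≡-dec)
  open import Function using (_∘_)
  open import Function.Bundles using (Inverse; _↔_; mk↔ₛ′)
  open import Function.Properties.Inverse using (↔-sym)
  open import Relation.Nullary using (Dec; yes; no)
  open import Relation.Nullary.Decidable using (⌊_⌋; T?; _→-dec_; map′)
  open import Relation.Binary.Definitions using (DecidableEquality)
  open import Relation.Binary.PropositionalEquality

  T-injective : ∀ {a b} → (T a → T b) → (T b → T a) → a ≡ b
  T-injective {true} {true} f g = refl
  T-injective {true} {false} f g = ⊥-elim (f tt)
  T-injective {false} {true} f g = ⊥-elim (g tt)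
  T-injective {false} {false} f g = refl

  partition-by : ∀ {A Cc : Set} (b : A → Bool) (f : A → Cc) (_≟_ : DecidableEquality Cc) →
    Sub A b ↔ Σ Cc (λ c → Sub A (λ a → b a ∧ ⌊ f a ≟ c ⌋))
  partition-by {A} {Cc} b f _≟_ = mk↔ₛ′ to from tf ft
    where
    to : Sub A b → Σ Cc (λ c → Sub A (λ a → b a ∧ ⌊ f a ≟ c ⌋))
    to (a , t) = f a , a , ∧T t (dec-T (f a ≟ f a) refl)
    from : Σ Cc (λ c → Sub A (λ a → b a ∧ ⌊ f a ≟ c ⌋)) → Sub A b
    from (c , a , t) = a , proj₁ (T∧ t)
    tf : ∀ x → to (from x) ≡ x
    tf (c , a , t) with T-dec (f a ≟ c) (proj₂ (T∧ {b a} t))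
    ... | refl = cong (f a ,_) (Sub-≡ refl)
    ft : ∀ x → from (to x) ≡ x
    ft (a , t) = Sub-≡ refl

  Σ-restrict : ∀ {Cc : Set} (F : Cc → Set) (b : Cc → Bool) → (∀ c → F c → T (b c)) → Σ Cc F ↔ Σ (Sub Cc b) (F ∘ proj₁)
  Σ-restrict {Cc} F b w = mk↔ₛ′ (λ { (c , x) → (c , w c x) , x }) (λ { ((c , _) , x) → c , x })
    (λ { ((c , t) , x) → cong (λ t' → (c , t') , x) (BP.T-irrelevant _ _) }) (λ _ → refl)

  card-trueIndices : ∀ {N} (t : Vec Bool N) → Card (Sub (Fin N) (lookup t)) (countTrue t)
  card-trueIndices [] = card-empty (λ { (() , _) })
  card-trueIndices (true ∷ t) = card-resp (↔-sym (Σ-suc (T ∘ lookup (true ∷ t)))) (card-⊎ card-⊤ (card-trueIndices t))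
  card-trueIndices (false ∷ t) = card-resp (↔-sym (Σ-suc (T ∘ lookup (false ∷ t)))) (card-⊎ card-⊥ (card-trueIndices t))

  T⇒≡true : ∀ {a} → T a → a ≡ true
  T⇒≡true {true} _ = refl

  module Count {n N d' : ℕ} (ρ : Fin n → Fin N) (fib : ∀ y → Card (Sub (Fin n) (λ x → ⌊ ρ x ≟F y ⌋)) (suc d')) where
    d : ℕ
    d = suc d'
    open VecMembership (_≟F_ {n}) using (member; distinct; member-sound; member-complete; distinct⇒injective; injective⇒distinct)

    _≟V_ : DecidableEquality (Vec Bool N)
    _≟V_ = ≡-dec BP._≟_

    IsFibreUnion : ∀ {m} → Vec (Fin n) m → Set
    IsFibreUnion v = ∀ i x → ρ x ≡ ρ (lookup v i) → T (member x v)

    isFibreUnion? : ∀ {m} (v : Vec (Fin n) m) → Dec (IsFibreUnion v)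
    isFibreUnion? v = all? (λ i → all? (λ x → (ρ x ≟F ρ (lookup v i)) →-dec T? (member x v)))

    distinctFibreUnion : ∀ {m} → Vec (Fin n) m → Bool
    distinctFibreUnion v = distinct v ∧ ⌊ isFibreUnion? v ⌋

    hitsFibre : ∀ {m} → Vec (Fin n) m → Fin N → Bool
    hitsFibre v y = ⌊ any? (λ i → ρ (lookup v i) ≟F y) ⌋

    fibreImage : ∀ {m} → Vec (Fin n) m → Vec Bool N
    fibreImage v = tabulate (hitsFibre v)

    card-preimage : (t : Vec Bool N) → Card (Sub (Fin n) (λ x → lookup t (ρ x))) (countTrue t * d)
    card-preimage t =
      card-resp (↔-sym (partition-by (λ x → lookup t (ρ x)) ρ _≟F_))
        (card-resp (↔-sym (Σ-restrict F (lookup t) wit))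
          (subst (Card _) (sumFin-const (countTrue t) d)
            (card-Σ (card-trueIndices t) (F ∘ proj₁) (λ _ → d) (λ s → card-resp (Sub-cong _ _ (eqb s)) (fib (proj₁ s))))))
      where
      F : Fin N → Set
      F y = Sub (Fin n) (λ x → lookup t (ρ x) ∧ ⌊ ρ x ≟F y ⌋)
      wit : ∀ y → F y → T (lookup t y)
      wit y (x , p) with T∧ {lookup t (ρ x)} p
      ... | p1 , p2 = subst (T ∘ lookup t) (T-dec (ρ x ≟F y) p2) p1
      eqb : (s : Sub (Fin N) (lookup t)) → ∀ x → ⌊ ρ x ≟F proj₁ s ⌋ ≡ lookup t (ρ x) ∧ ⌊ ρ x ≟F proj₁ s ⌋
      eqb (y , ty) x with ρ x ≟F y
      ... | yes refl = sym (cong (_∧ true) (T⇒≡true ty))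
      ... | no _ = sym (BP.∧-zeroʳ _)

    WithFibreImage : ∀ m → Vec Bool N → Set
    WithFibreImage m t = Sub (Vec (Fin n) m) (λ v → distinctFibreUnion v ∧ ⌊ fibreImage v ≟V t ⌋)

    module _ {m} (t : Vec Bool N) (v : Vec (Fin n) m) (g : T (distinctFibreUnion v ∧ ⌊ fibreImage v ≟V t ⌋)) where
      distinct-v : T (distinct v)
      distinct-v = proj₁ (T∧ (proj₁ (T∧ g)))
      fibreUnion-v : IsFibreUnion v
      fibreUnion-v = T-dec (isFibreUnion? v) (proj₂ (T∧ {distinct v} (proj₁ (T∧ g))))
      fibreImage-v : fibreImage v ≡ t
      fibreImage-v = T-dec (fibreImage v ≟V t) (proj₂ (T∧ {distinctFibreUnion v} g))
      entry-in-preimage : ∀ i → T (lookup t (ρ (lookup v i)))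
      entry-in-preimage i = subst (λ t' → T (lookup t' (ρ (lookup v i)))) fibreImage-v
               (subst T (sym (lookup∘tabulate (hitsFibre v) (ρ (lookup v i)))) (dec-T (any? (λ j → ρ (lookup v j) ≟F ρ (lookup v i))) (i , refl)))
      preimage-covered : ∀ x → T (lookup t (ρ x)) → ∃ λ j → lookup v j ≡ x
      preimage-covered x p = member-sound x v (fibreUnion-v i x (sym eq))
        where
        p' : T (hitsFibre v (ρ x))
        p' = subst T (lookup∘tabulate (hitsFibre v) (ρ x)) (subst (λ t' → T (lookup t' (ρ x))) (sym fibreImage-v) p)
        i = proj₁ (T-dec (any? (λ j → ρ (lookup v j) ≟F ρ x)) p')
        eq = proj₂ (T-dec (any? (λ j → ρ (lookup v j) ≟F ρ x)) p')

    fibreImage-size : ∀ {m} t → WithFibreImage m t → countTrue t * d ≡ m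
    fibreImage-size {m} t (v , g) = card-unique (card-preimage t) cz
      where
      cz : Card (Sub (Fin n) (λ x → lookup t (ρ x))) m
      cz = mk↔ₛ′ (λ i → lookup v i , entry-in-preimage t v g i) (λ s → proj₁ (preimage-covered t v g (proj₁ s) (proj₂ s)))
        (λ s → Sub-≡ (proj₂ (preimage-covered t v g (proj₁ s) (proj₂ s))))
        (λ i → distinct⇒injective v (distinct-v t v g) (proj₂ (preimage-covered t v g (lookup v i) (entry-in-preimage t v g i))))

    module _ (t : Vec Bool N) where
      Preimage : Set
      Preimage = Sub (Fin n) (λ x → lookup t (ρ x))
      _≟P_ : DecidableEquality Preimage
      a ≟P b = map′ Sub-≡ (cong proj₁) (proj₁ a ≟F proj₁ b)
      module DZ = VecMembership _≟P_
      module D2 = InjectiveMap _≟P_ _≟F_ proj₁ Sub-≡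

      module _ {m} (size : countTrue t * d ≡ m) where
        card-Preimage : Card Preimage m
        card-Preimage = subst (Card Preimage) size (card-preimage t)

        toPreimages : WithFibreImage m t → Vec Preimage m
        toPreimages (v , g) = tabulate (λ i → lookup v i , entry-in-preimage t v g i)

        distinct-toPreimages : ∀ s → T (DZ.distinct (toPreimages s))
        distinct-toPreimages (v , g) = DZ.injective⇒distinct (toPreimages (v , g)) (λ {i} {j} e →
          distinct⇒injective v (distinct-v t v g)
            (cong proj₁ (trans (sym (lookup∘tabulate entry i)) (trans e (lookup∘tabulate entry j)))))
          where
          entry : Fin m → Preimage
          entry i = lookup v i , entry-in-preimage t v g i

        module _ (s : Sub (Vec Preimage m) DZ.distinct) where
          private
            w : Vec Preimage m
            w = proj₁ s
            dw = proj₂ s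
            v : Vec (Fin n) m
            v = map proj₁ w

          entries-in-preimage : ∀ i → T (lookup t (ρ (lookup v i)))
          entries-in-preimage i = subst (λ z → T (lookup t (ρ z))) (sym (lookup-map i proj₁ w)) (proj₂ (lookup w i))

          preimage-covered-by : ∀ x → T (lookup t (ρ x)) → ∃ λ j → lookup v j ≡ x
          preimage-covered-by x p = proj₁ r , trans (lookup-map (proj₁ r) proj₁ w) (cong proj₁ (proj₂ r))
            where
            r = DZ.member-sound (x , p) w (distinct-full _≟P_ card-Preimage w dw (x , p))

          fibreUnion-projections : IsFibreUnion v
          fibreUnion-projections i x e =
            let (j , e') = preimage-covered-by x (subst (T ∘ lookup t) (sym e) (entries-in-preimage i))
            in member-complete x v j e'

          hitsFibre-projections : ∀ y → hitsFibre v y ≡ lookup t y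
          hitsFibre-projections y = T-injective hit⇒t t⇒hit
            where
            hit⇒t : T (hitsFibre v y) → T (lookup t y)
            hit⇒t h = subst (T ∘ lookup t) (proj₂ r) (entries-in-preimage (proj₁ r))
              where
              r = T-dec (any? (λ i → ρ (lookup v i) ≟F y)) h
            t⇒hit : T (lookup t y) → T (hitsFibre v y)
            t⇒hit ty = dec-T (any? (λ i → ρ (lookup v i) ≟F y)) (proj₁ r , trans (cong ρ (proj₂ r)) ρx≡y)
              where
              x = proj₁ (card-inhabited (fib y))
              ρx≡y : ρ x ≡ y
              ρx≡y = T-dec (ρ x ≟F y) (proj₂ (card-inhabited (fib y)))
              r = preimage-covered-by x (subst (T ∘ lookup t) (sym ρx≡y) ty)

          projections-WithFibreImage : T (distinctFibreUnion v ∧ ⌊ fibreImage v ≟V t ⌋)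
          projections-WithFibreImage =
            ∧T (∧T (subst T (sym (D2.distinct-map w)) dw) (dec-T (isFibreUnion? v) fibreUnion-projections))
               (dec-T (fibreImage v ≟V t) (trans (tabulate-cong hitsFibre-projections) (tabulate∘lookup t)))

        WithFibreImage↔distinctPreimages : WithFibreImage m t ↔ Sub (Vec Preimage m) DZ.distinct
        WithFibreImage↔distinctPreimages = Sub-↔-mk _ _ toPreimages (map proj₁ ∘ proj₁)
          distinct-toPreimages projections-WithFibreImage
          (λ (w , _) → trans (tabulate-cong (λ i → Sub-≡ (lookup-map i proj₁ w))) (tabulate∘lookup w))
          (λ (v , _) → trans (sym (tabulate-∘ proj₁ _)) (tabulate∘lookup v))

        card-WithFibreImage : Card (WithFibreImage m t) (m !)
        card-WithFibreImage = card-resp (↔-sym WithFibreImage↔distinctPreimages)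
          (subst (Card _) (fallingFactorial[n,n]≡n! m) (card-distinct _≟P_ card-Preimage m))

    card-distinctFibreUnion : ∀ m j → j * d ≡ m → Card (Sub (Vec (Fin n) m) distinctFibreUnion) ((N C j) * m !)
    card-distinctFibreUnion m j eq =
      card-resp (↔-sym (partition-by distinctFibreUnion fibreImage _≟V_))
        (card-resp (↔-sym (Σ-restrict (WithFibreImage m) (λ t → countTrue t ≡ᵇ j) wit))
          (subst (Card _) (sumFin-const (N C j) (m !))
            (card-Σ (card-subsets N j) (WithFibreImage m ∘ proj₁) (λ _ → m !)
              (λ s → card-WithFibreImage (proj₁ s) (trans (cong (_* d) (≡ᵇ⇒≡ (countTrue (proj₁ s)) j (proj₂ s))) eq)))))
      where
      wit : ∀ t → WithFibreImage m t → T (countTrue t ≡ᵇ j)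
      wit t x = ≡⇒≡ᵇ (countTrue t) j (*-cancelʳ-≡ (countTrue t) j d (trans (fibreImage-size t x) (sym eq)))

    card-distinctFibreUnion-indivisible : ∀ m → (∀ j → j * d ≢ m) → Card (Sub (Vec (Fin n) m) distinctFibreUnion) 0
    card-distinctFibreUnion-indivisible m h = card-empty λ s →
      let (t , x) = Inverse.to (partition-by distinctFibreUnion fibreImage _≟V_) s
      in h (countTrue t) (fibreImage-size t x)


module CyclicShift where

  open Cardinality
  open DistinctVectors
  open import Data.Nat using (ℕ; zero; suc; _+_; _*_; _∸_; _≤_; _<_; NonZero; _%_; _/_; ≢-nonZero)
  open import Data.Nat.Properties
  open import Data.Nat.DivMod
  open import Data.Nat.Divisibility using (_∣_; divides; divides-refl)
  open import Data.Nat.GCD using (gcd; gcd-GCD; gcd[m,n]∣m; gcd[m,n]≡0⇒n≡0; module Bézout)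
  open import Data.Nat.Solver using (module +-*-Solver)
  open import Data.Fin using (Fin; zero; suc; toℕ; fromℕ<)
  open import Data.Fin.Properties using (all?; toℕ-fromℕ<; toℕ-injective; toℕ<n) renaming (_≟_ to _≟F_)
  open import Data.Bool using (T)
  open import Data.Product using (_,_; proj₁; proj₂)
  open import Data.Vec using (Vec; lookup)
  open import Function.Bundles using (mk↔ₛ′)
  open import Relation.Nullary using (Dec)
  open import Relation.Nullary.Decidable using (⌊_⌋; T?)
  open import Relation.Binary.PropositionalEquality

  module Shift (n' : ℕ) where
    n : ℕ
    n = suc n'
    open VecMembership (_≟F_ {n}) using (member; member-sound; member-complete)

    _⊕_ : Fin n → ℕ → Fin n
    a ⊕ s = fromℕ< (m%n<n (toℕ a + s) n)

    toℕ-⊕ : ∀ a s → toℕ (a ⊕ s) ≡ (toℕ a + s) % n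
    toℕ-⊕ a s = toℕ-fromℕ< _

    ShiftClosed : ∀ {m} → ℕ → Vec (Fin n) m → Set
    ShiftClosed s v = ∀ i → T (member (lookup v i ⊕ s) v)

    shiftClosed? : ∀ {m} s (v : Vec (Fin n) m) → Dec (ShiftClosed s v)
    shiftClosed? s v = all? (λ i → T? (member (lookup v i ⊕ s) v))

    [m%n+o]%n≡[m+o]%n : ∀ a b → (a % n + b) % n ≡ (a + b) % n
    [m%n+o]%n≡[m+o]%n a b = begin
        (a % n + b) % n
      ≡⟨ %-distribˡ-+ (a % n) b n ⟩
        (a % n % n + b % n) % n
      ≡⟨ cong (λ z → (z + b % n) % n) (m%n%n≡m%n a n) ⟩
        (a % n + b % n) % n
      ≡⟨ sym (%-distribˡ-+ a b n) ⟩
        (a + b) % n ∎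
      where open ≡-Reasoning

    ⊕-0 : ∀ a → a ⊕ 0 ≡ a
    ⊕-0 a = toℕ-injective (trans (toℕ-⊕ a 0) (trans (cong (_% n) (+-identityʳ (toℕ a))) (m<n⇒m%n≡m (toℕ<n a))))

    ⊕-⊕ : ∀ a s t → (a ⊕ s) ⊕ t ≡ a ⊕ (s + t)
    ⊕-⊕ a s t = toℕ-injective (begin
        toℕ ((a ⊕ s) ⊕ t)
      ≡⟨ toℕ-⊕ (a ⊕ s) t ⟩
        (toℕ (a ⊕ s) + t) % n
      ≡⟨ cong (λ z → (z + t) % n) (toℕ-⊕ a s) ⟩
        ((toℕ a + s) % n + t) % n
      ≡⟨ [m%n+o]%n≡[m+o]%n (toℕ a + s) t ⟩
        (toℕ a + s + t) % n
      ≡⟨ cong (_% n) (+-assoc (toℕ a) s t) ⟩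
        (toℕ a + (s + t)) % n
      ≡⟨ sym (toℕ-⊕ a (s + t)) ⟩
        toℕ (a ⊕ (s + t)) ∎)
      where open ≡-Reasoning

    ⊕-mod : ∀ a s s' → s % n ≡ s' % n → a ⊕ s ≡ a ⊕ s'
    ⊕-mod a s s' eq = toℕ-injective (begin
        toℕ (a ⊕ s)
      ≡⟨ toℕ-⊕ a s ⟩
        (toℕ a + s) % n
      ≡⟨ %-distribˡ-+ (toℕ a) s n ⟩
        (toℕ a % n + s % n) % n
      ≡⟨ cong (λ z → (toℕ a % n + z) % n) eq ⟩
        (toℕ a % n + s' % n) % n
      ≡⟨ sym (%-distribˡ-+ (toℕ a) s' n) ⟩
        (toℕ a + s') % n
      ≡⟨ sym (toℕ-⊕ a s') ⟩
        toℕ (a ⊕ s') ∎)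
      where open ≡-Reasoning

    shiftClosed-* : ∀ {m} s (v : Vec (Fin n) m) → ShiftClosed s v → ∀ t → ShiftClosed (t * s) v
    shiftClosed-* s v cs zero i = member-complete _ v i (sym (⊕-0 (lookup v i)))
    shiftClosed-* s v cs (suc t) i = subst (λ z → T (member z v)) eq (cs j)
      where
      r = member-sound _ v (shiftClosed-* s v cs t i)
      j = proj₁ r
      eq : lookup v j ⊕ s ≡ lookup v i ⊕ (s + t * s)
      eq = trans (cong (_⊕ s) (proj₂ r)) (trans (⊕-⊕ (lookup v i) (t * s) s) (cong (lookup v i ⊕_) (+-comm (t * s) s)))

    shiftClosed-mod : ∀ {m} s s' (v : Vec (Fin n) m) → ShiftClosed s v → s % n ≡ s' % n → ShiftClosed s' v
    shiftClosed-mod s s' v cs eq i = subst (λ z → T (member z v)) (⊕-mod (lookup v i) s s' eq) (cs i)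

    module _ (k : ℕ) where
      N : ℕ
      N = gcd k n

      -- By Bézout, N ≡ t * k (mod n) for some t, and closure under k gives closure under t * k.
      shiftClosed⇒shiftClosed-gcd : ∀ {m} (v : Vec (Fin n) m) → ShiftClosed k v → ShiftClosed N v
      shiftClosed⇒shiftClosed-gcd v cs with Bézout.identity (gcd-GCD k n)
      ... | Bézout.+- x y eq = shiftClosed-mod (x * k) N v (shiftClosed-* k v cs x)
             (trans (cong (_% n) (sym eq)) ([m+kn]%n≡m%n N y n))
      ... | Bézout.-+ x y eq = shiftClosed-mod (x * n' * k) N v (shiftClosed-* k v cs (x * n'))
             (trans (sym ([m+kn]%n≡m%n (x * n' * k) y n)) (trans (cong (_% n) multiple-eq) ([m+kn]%n≡m%n N (x * k) n)))
        where
        open +-*-Solver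
        multiple-eq : x * n' * k + y * n ≡ N + x * k * n
        multiple-eq = trans (cong (x * n' * k +_) (sym eq))
          (solve 4 (λ x n' k N → x :* n' :* k :+ (N :+ x :* k) := N :+ x :* k :* (con 1 :+ n')) refl x n' k N)

      shiftClosed-gcd⇒shiftClosed : ∀ {m} (v : Vec (Fin n) m) → ShiftClosed N v → ShiftClosed k v
      shiftClosed-gcd⇒shiftClosed v cs = subst (λ z → ShiftClosed z v) (m/n*n≡m {{nz}} (gcd[m,n]∣m k n)) (shiftClosed-* N v cs (_/_ k N {{nz}}))
        where
        nz : NonZero N
        nz = ≢-nonZero (λ e → 0≢1+n (sym (gcd[m,n]≡0⇒n≡0 k e)))

    module Residues (N d : ℕ) {{nzN : NonZero N}} (eqn : d * N ≡ n) where
      ρ : Fin n → Fin N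
      ρ x = fromℕ< (m%n<n (toℕ x) N)

      toℕ-ρ : ∀ x → toℕ (ρ x) ≡ toℕ x % N
      toℕ-ρ x = toℕ-fromℕ< _

      N∣n : N ∣ n
      N∣n = divides d (sym eqn)

      IsFibreUnion : ∀ {m} → Vec (Fin n) m → Set
      IsFibreUnion v = ∀ i x → ρ x ≡ ρ (lookup v i) → T (member x v)

      fibreUnion⇒shiftClosed : ∀ {m} (v : Vec (Fin n) m) → IsFibreUnion v → ShiftClosed N v
      fibreUnion⇒shiftClosed v fc i = fc i (lookup v i ⊕ N) (toℕ-injective (begin
          toℕ (ρ (lookup v i ⊕ N))
        ≡⟨ toℕ-ρ _ ⟩
          toℕ (lookup v i ⊕ N) % N
        ≡⟨ cong (_% N) (toℕ-⊕ (lookup v i) N) ⟩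
          (toℕ (lookup v i) + N) % n % N
        ≡⟨ m∣n⇒o%n%m≡o%m N n (toℕ (lookup v i) + N) N∣n ⟩
          (toℕ (lookup v i) + N) % N
        ≡⟨ [m+n]%n≡m%n (toℕ (lookup v i)) N ⟩
          toℕ (lookup v i) % N
        ≡⟨ sym (toℕ-ρ _) ⟩
          toℕ (ρ (lookup v i)) ∎))
        where open ≡-Reasoning

      residue-lift : ∀ X y → X % N ≡ y % N → y < n → y + (X / N + d ∸ y / N) * N ≡ X + n
      residue-lift X y eqm y<n = begin
          y + (X / N + d ∸ y / N) * N
        ≡⟨ cong (y +_) (*-distribʳ-∸ N (X / N + d) (y / N)) ⟩
          y + ((X / N + d) * N ∸ y / N * N)
        ≡⟨ cong (_+ ((X / N + d) * N ∸ y / N * N)) (m≡m%n+[m/n]*n y N) ⟩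
          (y % N + y / N * N) + ((X / N + d) * N ∸ y / N * N)
        ≡⟨ +-assoc (y % N) (y / N * N) _ ⟩
          y % N + (y / N * N + ((X / N + d) * N ∸ y / N * N))
        ≡⟨ cong (y % N +_) (m+[n∸m]≡n le) ⟩
          y % N + (X / N + d) * N
        ≡⟨ cong₂ _+_ (sym eqm) (*-distribʳ-+ N (X / N) d) ⟩
          X % N + (X / N * N + d * N)
        ≡⟨ sym (+-assoc (X % N) _ _) ⟩
          (X % N + X / N * N) + d * N
        ≡⟨ cong₂ _+_ (sym (m≡m%n+[m/n]*n X N)) eqn ⟩
          X + n ∎
        where
        open ≡-Reasoning
        y/N<d : y / N < d
        y/N<d = m<n*o⇒m/o<n (subst (y <_) (sym eqn) y<n)
        le : y / N * N ≤ (X / N + d) * N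
        le = *-monoˡ-≤ N (≤-trans (<⇒≤ y/N<d) (m≤n+m d (X / N)))

      shiftClosed⇒fibreUnion : ∀ {m} (v : Vec (Fin n) m) → ShiftClosed N v → IsFibreUnion v
      shiftClosed⇒fibreUnion v cs i x eq = subst (λ z → T (member z v)) e (shiftClosed-* N v cs t i)
        where
        X : ℕ
        X = toℕ x
        y : ℕ
        y = toℕ (lookup v i)
        t : ℕ
        t = X / N + d ∸ y / N
        eqm : X % N ≡ y % N
        eqm = trans (sym (toℕ-ρ x)) (trans (cong toℕ eq) (toℕ-ρ (lookup v i)))
        e : lookup v i ⊕ (t * N) ≡ x
        e = toℕ-injective (trans (toℕ-⊕ (lookup v i) (t * N))
              (trans (cong (_% n) (residue-lift X y eqm (toℕ<n (lookup v i))))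
                (trans ([m+n]%n≡m%n X n) (m<n⇒m%n≡m (toℕ<n x)))))

      card-residueClass : ∀ y → Card (Sub (Fin n) (λ x → ⌊ ρ x ≟F y ⌋)) d
      card-residueClass y = mk↔ₛ′ to from tf ft
        where
        Y : ℕ
        Y = toℕ y
        lt : ∀ (a : Fin d) → toℕ a * N + Y < n
        lt a = subst (toℕ a * N + Y <_) eqn (≤-trans (+-monoʳ-< (toℕ a * N) (toℕ<n y)) (subst (_≤ d * N) (+-comm N
            (toℕ a * N)) (*-monoˡ-≤ N (toℕ<n a))))
        modY : ∀ a → (a * N + Y) % N ≡ Y
        modY a = trans (cong (_% N) (+-comm (a * N) Y)) (trans ([m+kn]%n≡m%n Y a N) (m<n⇒m%n≡m (toℕ<n y)))
        to : Fin d → Sub (Fin n) (λ x → ⌊ ρ x ≟F y ⌋)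
        to a = fromℕ< (lt a) , dec-T (ρ _ ≟F y) (toℕ-injective (trans (toℕ-ρ _) (trans (cong (_% N) (toℕ-fromℕ< (lt a))) (modY (toℕ a)))))
        from : Sub (Fin n) (λ x → ⌊ ρ x ≟F y ⌋) → Fin d
        from (x , _) = fromℕ< (m<n*o⇒m/o<n (subst (toℕ x <_) (sym eqn) (toℕ<n x)))
        tf : ∀ s → to (from s) ≡ s
        tf (x , px) = Sub-≡ (toℕ-injective (begin
            toℕ (fromℕ< (lt (from (x , px))))
          ≡⟨ toℕ-fromℕ< _ ⟩
            toℕ (from (x , px)) * N + Y
          ≡⟨ cong₂ (λ a b → a * N + b) (toℕ-fromℕ< (m<n*o⇒m/o<n (subst (toℕ x <_) (sym eqn) (toℕ<n x)))) (sym yv) ⟩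
            toℕ x / N * N + toℕ x % N
          ≡⟨ +-comm (toℕ x / N * N) _ ⟩
            toℕ x % N + toℕ x / N * N
          ≡⟨ sym (m≡m%n+[m/n]*n (toℕ x) N) ⟩
            toℕ x ∎))
          where
          open ≡-Reasoning
          yv : toℕ x % N ≡ Y
          yv = trans (sym (toℕ-ρ x)) (cong toℕ (T-dec (ρ x ≟F y) px))
        ft : ∀ a → from (to a) ≡ a
        ft a = toℕ-injective (begin
            toℕ (from (to a))
          ≡⟨ toℕ-fromℕ< _ ⟩
            toℕ (fromℕ< (lt a)) / N
          ≡⟨ cong (_/ N) (toℕ-fromℕ< (lt a)) ⟩
            (toℕ a * N + Y) / N
          ≡⟨ +-distrib-/-∣ˡ Y (divides-refl (toℕ a)) ⟩
            toℕ a * N / N + Y / N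
          ≡⟨ cong₂ _+_ (m*n/n≡m (toℕ a) N) (m<n⇒m/n≡0 (toℕ<n y)) ⟩
            toℕ a + 0
          ≡⟨ +-identityʳ _ ⟩
            toℕ a ∎)
          where open ≡-Reasoning


module ShiftClosedCount where

  open Cardinality
  open DistinctVectors
  open FibreUnions
  open CyclicShift
  open import Data.Nat using (ℕ; zero; suc; _*_; _/_; _!)
  open import Data.Nat.Properties
  open import Data.Nat.DivMod using (m/n*n≡m; m*n/n≡m)
  open import Data.Nat.Divisibility using (_∣_; _∣?_; divides)
  open import Data.Nat.GCD using (gcd; gcd[m,n]∣n; gcd[m,n]≡0⇒n≡0)
  open import Data.Nat.Combinatorics using (_C_)
  open import Data.Fin using (Fin; zero; suc)
  open import Data.Fin.Properties using () renaming (_≟_ to _≟F_)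
  open import Data.Empty using (⊥-elim)
  open import Data.Bool using (_∧_; if_then_else_)
  open import Data.Vec using (Vec)
  open import Relation.Nullary using (yes; no)
  open import Relation.Nullary.Decidable using (⌊_⌋)
  open import Relation.Binary.PropositionalEquality

  module ShiftClosedVectors (n' : ℕ) (m : ℕ) where
    open Shift n'
    open VecMembership (_≟F_ {n}) using (distinct)

    DistinctShiftClosed : ℕ → Set
    DistinctShiftClosed k = Sub (Vec (Fin n) m) (λ v → distinct v ∧ ⌊ shiftClosed? k v ⌋)

    countForPeriod : ℕ → ℕ
    countForPeriod zero = 0
    countForPeriod (suc d') = if ⌊ suc d' ∣? m ⌋ then ((n / suc d') C (m / suc d')) * m ! else 0

    countForGcd : ℕ → ℕ
    countForGcd zero = 0
    countForGcd (suc g') = countForPeriod (n / suc g')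

    module _ (k : ℕ) where
      card-for-period : ∀ g' → gcd k n ≡ suc g' → ∀ d → d * suc g' ≡ n → Card (DistinctShiftClosed k) (countForPeriod d)
      card-for-period g' gcd≡g zero d*g≡n = ⊥-elim (0≢1+n d*g≡n)
      card-for-period g' gcd≡g (suc d') d*g≡n = card-resp (Sub-cong _ _ fibreUnion≡shiftClosed) card-distinctFibreUnions
        where
        open Residues (suc g') (suc d') d*g≡n
        open Count ρ card-residueClass using (distinctFibreUnion; isFibreUnion?; card-distinctFibreUnion; card-distinctFibreUnion-indivisible)
        shiftClosed⇒fibreUnion-k : ∀ v → ShiftClosed k v → IsFibreUnion v
        shiftClosed⇒fibreUnion-k v cs = shiftClosed⇒fibreUnion v (subst (λ z → ShiftClosed z v) gcd≡g (shiftClosed⇒shiftClosed-gcd k v cs))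
        fibreUnion⇒shiftClosed-k : ∀ v → IsFibreUnion v → ShiftClosed k v
        fibreUnion⇒shiftClosed-k v fc = shiftClosed-gcd⇒shiftClosed k v (subst (λ z → ShiftClosed z v) (sym gcd≡g) (fibreUnion⇒shiftClosed v fc))
        fibreUnion≡shiftClosed : ∀ v → distinctFibreUnion v ≡ distinct v ∧ ⌊ shiftClosed? k v ⌋
        fibreUnion≡shiftClosed v = cong (distinct v ∧_) (T-injective (λ t → dec-T (shiftClosed? k v) (fibreUnion⇒shiftClosed-k v (T-dec (isFibreUnion? v) t)))
                                           (λ t → dec-T (isFibreUnion? v) (shiftClosed⇒fibreUnion-k v (T-dec (shiftClosed? k v) t))))
        n/d : n / suc d' ≡ suc g'
        n/d = trans (cong (_/ suc d') (sym d*g≡n)) (trans (cong (_/ suc d') (*-comm (suc d') (suc g'))) (m*n/n≡m (suc g') (suc d')))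
        card-distinctFibreUnions : Card (Sub (Vec (Fin n) m) distinctFibreUnion) (countForPeriod (suc d'))
        card-distinctFibreUnions with suc d' ∣? m
        ... | yes (divides j ej) = subst (λ z → Card (Sub (Vec (Fin n) m) distinctFibreUnion) ((z C (m / suc d')) * m !)) (sym n/d)
                (subst (λ z → Card (Sub (Vec (Fin n) m) distinctFibreUnion) ((suc g' C z) * m !)) (sym (trans
                    (cong (_/ suc d') ej) (m*n/n≡m j (suc d'))))
                   (card-distinctFibreUnion m j (sym ej)))
        ... | no ¬dv = card-distinctFibreUnion-indivisible m (λ j ej → ¬dv (divides j (sym ej)))

      card-for-gcd : ∀ g → gcd k n ≡ g → Card (DistinctShiftClosed k) (countForGcd g)
      card-for-gcd zero eg = ⊥-elim (0≢1+n (sym (gcd[m,n]≡0⇒n≡0 k eg)))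
      card-for-gcd (suc g') eg = card-for-period g' eg (n / suc g') (m/n*n≡m (subst (_∣ n) eg (gcd[m,n]∣n k n)))

      card-distinctShiftClosed : Card (DistinctShiftClosed k) (countForGcd (gcd k n))
      card-distinctShiftClosed = card-for-gcd (gcd k n) refl


module GcdClasses where

  open Cardinality
  open DistinctVectors
  open Enumeration using (sum-map-∘)
  open import Data.Nat using (ℕ; zero; suc; pred; _+_; _*_; _≤_; _<_; NonZero; _%_; _/_; s≤s; _≤?_; s≤s⁻¹; ≢-nonZero)
  open import Data.Nat.Properties
  open import Data.Nat.DivMod using (m%n<n; m<n⇒m%n≡m; n%n≡0; m*n/n≡m)
  open import Data.Nat.Divisibility using (_∣_; _∣?_; divides; ∣-refl)
  open import Data.Nat.GCD using (gcd; gcd-GCD; gcd[m,n]∣m; gcd[m,n]∣n; gcd[m,n]≡0⇒n≡0; GCD-*; c*gcd[m,n]≡gcd[cm,cn]; gcd-zeroˡ; GCD)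
  open import Data.Nat.Coprimality using (Coprime; coprime?; GCD≡1⇒coprime; coprime⇒gcd≡1; gcd≡1⇒coprime)
  open import Data.Fin using (Fin; zero; suc; toℕ; fromℕ<)
  open import Data.Fin.Properties using (toℕ-fromℕ<; toℕ-injective; toℕ<n)
  open import Data.Empty using (⊥-elim)
  open import Data.Sum using ([_,_]′)
  open import Data.Bool using (Bool; true; false; T; _∧_; if_then_else_)
  open import Data.Product using (Σ; _×_; _,_; proj₁; proj₂)
  open import Function using (_∘_; id)
  open import Function.Bundles using (Inverse; _↔_; mk↔ₛ′)
  open import Relation.Nullary using (Dec; yes; no)
  open import Relation.Nullary.Decidable using (⌊_⌋; isYes≗does)
  open import Relation.Binary.PropositionalEquality

  quot : ∀ {a b} → a ∣ b → ℕ
  quot = _∣_.quotient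

  qeq : ∀ {a b} (p : a ∣ b) → b ≡ quot p * a
  qeq = _∣_.equality

  coprime-self⇒≡1 : ∀ {D} → Coprime D D → D ≡ 1
  coprime-self⇒≡1 c = c (∣-refl , ∣-refl)

  gcd-*ʳ : ∀ a b c → gcd (a * c) (b * c) ≡ gcd a b * c
  gcd-*ʳ a b c = begin
      gcd (a * c) (b * c)
    ≡⟨ cong₂ gcd (*-comm a c) (*-comm b c) ⟩
      gcd (c * a) (c * b)
    ≡⟨ sym (c*gcd[m,n]≡gcd[cm,cn] c a b) ⟩
      c * gcd a b
    ≡⟨ *-comm c (gcd a b) ⟩
      gcd a b * c ∎
    where open ≡-Reasoning

  module ReducedFractions (n' : ℕ) where
    n : ℕ
    n = suc n'

    g : ℕ → ℕ
    g K = gcd K n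
    g≢0 : ∀ K → g K ≢ 0
    g≢0 K e = 0≢1+n (sym (gcd[m,n]≡0⇒n≡0 K e))
    denominator : ℕ → ℕ
    denominator K = quot (gcd[m,n]∣n K n)
    denominator-eq : ∀ K → n ≡ denominator K * g K
    denominator-eq K = qeq (gcd[m,n]∣n K n)
    numerator : ℕ → ℕ
    numerator K = quot (gcd[m,n]∣m K n)
    numerator-eq : ∀ K → K ≡ numerator K * g K
    numerator-eq K = qeq (gcd[m,n]∣m K n)
    denominator≢0 : ∀ K → denominator K ≢ 0
    denominator≢0 K e = 0≢1+n (sym (trans (denominator-eq K) (cong (_* g K) e)))
    denominator≤n : ∀ K → denominator K ≤ n
    denominator≤n K = subst (denominator K ≤_) (sym (denominator-eq K)) (m≤m*n (denominator K) (g K) {{≢-nonZero (g≢0 K)}})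
    numerator<denominator : ∀ K → K < n → numerator K < denominator K
    numerator<denominator K lt = *-cancelʳ-< (g K) (numerator K) (denominator K) (subst₂ _<_ (numerator-eq K) (denominator-eq K) lt)
    pred-denominator<n : ∀ K → pred (denominator K) < n
    pred-denominator<n K = subst (_≤ n) (sym (suc-pred (denominator K) {{≢-nonZero (denominator≢0 K)}})) (denominator≤n K)
    pred-numerator<n : ∀ K → K < n → pred (numerator K) < n
    pred-numerator<n K lt = ≤-<-trans (pred-mono-≤ (<⇒≤ (numerator<denominator K lt))) (pred-denominator<n K)

    -- (i , j) encodes the fraction (1 + j)/(1 + i) in lowest terms with 1 + i ∣ n; k : Fin n stands for k/n.
    isReduced : Fin n → Fin n → Bool
    isReduced i j = ⌊ suc (toℕ i) ∣? n ⌋ ∧ (⌊ toℕ j ≤? toℕ i ⌋ ∧ ⌊ coprime? (suc (toℕ j)) (suc (toℕ i)) ⌋)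

    ReducedFraction : Set
    ReducedFraction = Sub (Fin n × Fin n) (λ p → isReduced (proj₁ p) (proj₂ p))

    coprime-numerator-denominator : ∀ K → Coprime (suc (pred (numerator K))) (denominator K)
    coprime-numerator-denominator K with numerator K in ea
    ... | zero = gcd≡1⇒coprime (gcd-zeroˡ (denominator K))
    ... | suc a' = GCD≡1⇒coprime (GCD-* {{nz}} (subst₂ (λ x y → GCD x y (1 * g K)) e1 e2 gg))
      where
      nz : NonZero (g K)
      nz with g K | g≢0 K
      ... | zero | h = ⊥-elim (h refl)
      ... | suc _ | _ = _
      gg : GCD K n (1 * g K)
      gg = subst (GCD K n) (sym (*-identityˡ (g K))) (gcd-GCD K n)
      e1 : K ≡ suc a' * g K
      e1 = trans (numerator-eq K) (cong (_* g K) ea)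
      e2 : n ≡ denominator K * g K
      e2 = denominator-eq K

    reduce : Fin n → ReducedFraction
    reduce k = (fromℕ< (pred-denominator<n K) , fromℕ< (pred-numerator<n K (toℕ<n k))) , ∧T c1 (∧T c2 c3)
      where
      K : ℕ
      K = toℕ k
      ei : suc (toℕ (fromℕ< (pred-denominator<n K))) ≡ denominator K
      ei = trans (cong suc (toℕ-fromℕ< (pred-denominator<n K))) (suc-pred (denominator K) {{≢-nonZero (denominator≢0 K)}})
      c1 : T ⌊ suc (toℕ (fromℕ< (pred-denominator<n K))) ∣? n ⌋
      c1 = dec-T (suc (toℕ (fromℕ< (pred-denominator<n K))) ∣? n) (subst (_∣ n) (sym ei) (divides (g K) (trans
          (denominator-eq K) (*-comm (denominator K) (g K)))))
      c2 : T ⌊ toℕ (fromℕ< (pred-numerator<n K (toℕ<n k))) ≤? toℕ (fromℕ< (pred-denominator<n K)) ⌋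
      c2 = dec-T (_ ≤? _) (subst₂ _≤_ (sym (toℕ-fromℕ< (pred-numerator<n K (toℕ<n k)))) (sym (toℕ-fromℕ<
          (pred-denominator<n K))) (pred-mono-≤ (<⇒≤ (numerator<denominator K (toℕ<n k)))))
      c3 : T ⌊ coprime? (suc (toℕ (fromℕ< (pred-numerator<n K (toℕ<n k))))) (suc (toℕ (fromℕ< (pred-denominator<n K)))) ⌋
      c3 = dec-T (coprime? _ _) (subst₂ Coprime (cong suc (sym (toℕ-fromℕ< (pred-numerator<n K (toℕ<n k)))))
          (sym ei) (coprime-numerator-denominator K))

    expand : ReducedFraction → Fin n
    expand ((i , j) , t) = fromℕ< (m%n<n (suc (toℕ j) * quot (T-dec (suc (toℕ i) ∣? n) (proj₁ (T∧ t)))) n)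

    cofactor : ReducedFraction → ℕ
    cofactor ((i , j) , t) = quot (T-dec (suc (toℕ i) ∣? n) (proj₁ (T∧ t)))

    cofactor-eq : ∀ s → n ≡ cofactor s * suc (toℕ (proj₁ (proj₁ s)))
    cofactor-eq ((i , j) , t) = qeq (T-dec (suc (toℕ i) ∣? n) (proj₁ (T∧ t)))

    expandℕ : ReducedFraction → ℕ
    expandℕ s = (suc (toℕ (proj₂ (proj₁ s))) * cofactor s) % n

    toℕ-expand : ∀ s → toℕ (expand s) ≡ expandℕ s
    toℕ-expand ((i , j) , t) = toℕ-fromℕ< _

    numerator*gcd%n : ∀ K → K < n → (suc (pred (numerator K)) * g K) % n ≡ K
    numerator*gcd%n K lt with numerator K in ea
    ... | zero = trans (cong (λ z → (1 * z) % n) g0) (trans (cong (_% n) (*-identityˡ n)) (trans (n%n≡0 n) (sym K0)))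
      where
      K0 : K ≡ 0
      K0 = trans (numerator-eq K) (cong (_* g K) ea)
      g0 : g K ≡ n
      g0 = cong (λ z → gcd z n) K0
    ... | suc a' = trans (cong (_% n) (sym (trans (numerator-eq K) (cong (_* g K) ea)))) (m<n⇒m%n≡m lt)

    expand-reduce : ∀ k → expand (reduce k) ≡ k
    expand-reduce k = toℕ-injective (begin
        toℕ (expand (reduce k))
      ≡⟨ toℕ-expand (reduce k) ⟩
        (suc (toℕ (fromℕ< (pred-numerator<n K (toℕ<n k)))) * cofactor (reduce k)) % n
      ≡⟨ cong₂ (λ a b → (suc a * b) % n) (toℕ-fromℕ< (pred-numerator<n K (toℕ<n k))) cg ⟩
        (suc (pred (numerator K)) * g K) % n
      ≡⟨ numerator*gcd%n K (toℕ<n k) ⟩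
        K ∎)
      where
      open ≡-Reasoning
      K : ℕ
      K = toℕ k
      eD : suc (toℕ (fromℕ< (pred-denominator<n K))) ≡ denominator K
      eD = trans (cong suc (toℕ-fromℕ< (pred-denominator<n K))) (suc-pred (denominator K) {{≢-nonZero (denominator≢0 K)}})
      cg : cofactor (reduce k) ≡ g K
      cg = *-cancelʳ-≡ _ _ (denominator K) {{≢-nonZero (denominator≢0 K)}}
             (trans (sym (trans (cofactor-eq (reduce k)) (cong (cofactor (reduce k) *_) eD))) (trans
                 (denominator-eq K) (*-comm (denominator K) (g K))))

    gcd-reduce : ∀ k → g (toℕ k) ≡ n / suc (toℕ (proj₁ (proj₁ (reduce k))))
    gcd-reduce k = sym (trans (cong (_/ suc I) e) (m*n/n≡m (g K) (suc I)))
      where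
      K : ℕ
      K = toℕ k
      I : ℕ
      I = toℕ (fromℕ< (pred-denominator<n K))
      eD : suc I ≡ denominator K
      eD = trans (cong suc (toℕ-fromℕ< (pred-denominator<n K))) (suc-pred (denominator K) {{≢-nonZero (denominator≢0 K)}})
      e : n ≡ g K * suc I
      e = trans (denominator-eq K) (trans (*-comm (denominator K) (g K)) (cong (g K *_) (sym eD)))

    fraction-unique : ∀ K a d c → K ≡ a * c → n ≡ d * c → Coprime a d → numerator K ≡ a × denominator K ≡ d
    fraction-unique K a d c K≡ac n≡dc a⊥d = cancel (numerator-eq K) K≡ac , cancel (denominator-eq K) n≡dc
      where
      open ≡-Reasoning
      c≢0 : c ≢ 0
      c≢0 e = 0≢1+n (sym (trans n≡dc (trans (cong (d *_) e) (*-zeroʳ d))))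
      g≡c : g K ≡ c
      g≡c = begin
        gcd K n              ≡⟨ cong₂ gcd K≡ac n≡dc ⟩
        gcd (a * c) (d * c)  ≡⟨ gcd-*ʳ a d c ⟩
        gcd a d * c          ≡⟨ cong (_* c) (coprime⇒gcd≡1 a⊥d) ⟩
        1 * c                ≡⟨ *-identityˡ c ⟩
        c                    ∎
      cancel : ∀ {x y b} → y ≡ x * g K → y ≡ b * c → x ≡ b
      cancel {x} {y} {b} y≡xg y≡bc =
        *-cancelʳ-≡ x b c {{≢-nonZero c≢0}} (trans (cong (x *_) (sym g≡c)) (trans (sym y≡xg) y≡bc))

    ReducesBackTo : ℕ → ReducedFraction → Set
    ReducesBackTo K ((i , j) , _) = pred (denominator K) ≡ toℕ i × pred (numerator K) ≡ toℕ j

    module _ (s : ReducedFraction) where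
      private
        i : ℕ
        i = toℕ (proj₁ (proj₁ s))
        j : ℕ
        j = toℕ (proj₂ (proj₁ s))
        isReduced-s = proj₂ (T∧ {⌊ suc i ∣? n ⌋} (proj₂ s))

      numerator≤denominator : j ≤ i
      numerator≤denominator = T-dec (j ≤? i) (proj₁ (T∧ isReduced-s))

      numerator⊥denominator : Coprime (suc j) (suc i)
      numerator⊥denominator = T-dec (coprime? (suc j) (suc i)) (proj₂ (T∧ {⌊ j ≤? i ⌋} isReduced-s))

      -- The fraction 1/1 expands to K = n % n = 0, whose reduced form 0/1 has the same predecessors.
      reduce-expand-one : j ≡ i → ReducesBackTo (expandℕ s) s
      reduce-expand-one j≡i = cong pred (proj₂ zero-reduced) , trans (cong pred (proj₁ zero-reduced)) (sym j≡0)
        where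
        i≡0 : i ≡ 0
        i≡0 = suc-injective (coprime-self⇒≡1 (subst (λ z → Coprime (suc z) (suc i)) j≡i numerator⊥denominator))
        j≡0 : j ≡ 0
        j≡0 = trans j≡i i≡0
        cofactor≡n : cofactor s ≡ n
        cofactor≡n = sym (trans (cofactor-eq s) (trans (cong (λ z → cofactor s * suc z) i≡0) (*-identityʳ (cofactor s))))
        expand≡0 : expandℕ s ≡ 0
        expand≡0 = trans (cong₂ (λ a b → (suc a * b) % n) j≡0 cofactor≡n) (trans (cong (_% n) (*-identityˡ n)) (n%n≡0 n))
        zero-reduced : numerator (expandℕ s) ≡ 0 × denominator (expandℕ s) ≡ suc i
        zero-reduced = fraction-unique (expandℕ s) 0 (suc i) n expand≡0 (trans (sym (*-identityˡ n)) (cong (_* n) (cong suc (sym i≡0))))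
          (gcd≡1⇒coprime {0} {suc i} (cong suc i≡0))

      reduce-expand-proper : j < i → ReducesBackTo (expandℕ s) s
      reduce-expand-proper j<i = cong pred (proj₂ reduced) , cong pred (proj₁ reduced)
        where
        c : ℕ
        c = cofactor s
        n≡ic : n ≡ suc i * c
        n≡ic = trans (cofactor-eq s) (*-comm c (suc i))
        c≢0 : c ≢ 0
        c≢0 e = 0≢1+n (sym (trans n≡ic (trans (cong (suc i *_) e) (*-zeroʳ (suc i)))))
        jc<n : suc j * c < n
        jc<n = subst (suc j * c <_) (sym n≡ic) (*-monoˡ-< c {{≢-nonZero c≢0}} (s≤s j<i))
        reduced : numerator (expandℕ s) ≡ suc j × denominator (expandℕ s) ≡ suc i
        reduced = fraction-unique (expandℕ s) (suc j) (suc i) c (m<n⇒m%n≡m jc<n) n≡ic numerator⊥denominator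

      reduce-expand-components : ReducesBackTo (expandℕ s) s
      reduce-expand-components = [ reduce-expand-proper , reduce-expand-one ]′ (m≤n⇒m<n∨m≡n numerator≤denominator)

    reduce-expand : ∀ s → reduce (expand s) ≡ s
    reduce-expand s@((i , j) , t) = Sub-≡ (cong₂ _,_
      (toℕ-injective (trans (toℕ-fromℕ< (pred-denominator<n (toℕ (expand s)))) (trans (cong (pred ∘ denominator)
          (toℕ-expand s)) (proj₁ (reduce-expand-components s)))))
      (toℕ-injective (trans (toℕ-fromℕ< (pred-numerator<n (toℕ (expand s)) (toℕ<n (expand s)))) (trans (cong
          (pred ∘ numerator) (toℕ-expand s)) (proj₂ (reduce-expand-components s))))))

    Fin↔ReducedFraction : Fin n ↔ ReducedFraction
    Fin↔ReducedFraction = mk↔ₛ′ reduce expand reduce-expand expand-reduce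

  open import Data.List using ([]; _∷_; map; filter; length; applyUpTo; upTo)
  open import Data.Nat.ListAction using (sum)
  open import Defs using (φ)
  open import Function.Properties.Inverse using (↔-sym; ↔-trans; ↔-refl)
  open import Data.Product.Function.Dependent.Propositional using (Σ-↔)
  open import Relation.Nullary using (does)

  len-filter : ∀ {A : Set} {P : A → Set} (P? : ∀ x → Dec (P x)) xs →
    length (filter P? xs) ≡ sum (map (λ x → if does (P? x) then 1 else 0) xs)
  len-filter P? [] = refl
  len-filter P? (x ∷ xs) with does (P? x)
  ... | true = cong suc (len-filter P? xs)
  ... | false = len-filter P? xs

  sum-filter : ∀ {A : Set} {P : A → Set} (P? : ∀ x → Dec (P x)) (h : A → ℕ) xs →
    sum (map h (filter P? xs)) ≡ sum (map (λ x → if does (P? x) then h x else 0) xs)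
  sum-filter P? h [] = refl
  sum-filter P? h (x ∷ xs) with does (P? x)
  ... | true = cong (h x +_) (sum-filter P? h xs)
  ... | false = sum-filter P? h xs

  sum-applyUpTo : ∀ {A : Set} (c : A → ℕ) (f : ℕ → A) d → sum (map c (applyUpTo f d)) ≡ sumFin d (λ i → c (f (toℕ i)))
  sum-applyUpTo c f zero = refl
  sum-applyUpTo c f (suc d) = cong (c (f 0) +_) (sum-applyUpTo c (f ∘ suc) d)

  coprimeTo : ∀ d → Fin d → Bool
  coprimeTo d j = ⌊ coprime? (suc (toℕ j)) d ⌋

  card-φ : ∀ d → Card (Sub (Fin d) (coprimeTo d)) (φ d)
  card-φ d = subst (Card _) (sym eq) (card-ΣFin d (T ∘ coprimeTo d) (λ j → if coprimeTo d j then 1 else 0) (λ j → card-T (coprimeTo d j)))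
    where
    eq : φ d ≡ sumFin d (λ j → if coprimeTo d j then 1 else 0)
    eq = trans (len-filter (λ k → coprime? k d) (map suc (upTo d)))
          (trans (sum-map-∘ (λ x → if does (coprime? x d) then 1 else 0) suc (upTo d))
            (trans (sum-applyUpTo (λ x → if does (coprime? (suc x) d) then 1 else 0) id d)
              (sumFin-cong d _ _ (λ j → cong (λ b → if b then 1 else 0) (sym (isYes≗does (coprime? (suc (toℕ j)) d)))))))

  restrict-Fin : ∀ {n} I → I < n → (P : ℕ → Bool) →
    Sub (Fin n) (λ j → ⌊ toℕ j ≤? I ⌋ ∧ P (toℕ j)) ↔ Sub (Fin (suc I)) (λ j → P (toℕ j))
  restrict-Fin {n} I I<n P = mk↔ₛ′ to from tf ft
    where
    to : Sub (Fin n) (λ j → ⌊ toℕ j ≤? I ⌋ ∧ P (toℕ j)) → Sub (Fin (suc I)) (λ j → P (toℕ j))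
    to (j , t) = fromℕ< (s≤s (T-dec (toℕ j ≤? I) (proj₁ (T∧ t)))) ,
                 subst (T ∘ P) (sym (toℕ-fromℕ< _)) (proj₂ (T∧ {⌊ toℕ j ≤? I ⌋} t))
    from : Sub (Fin (suc I)) (λ j → P (toℕ j)) → Sub (Fin n) (λ j → ⌊ toℕ j ≤? I ⌋ ∧ P (toℕ j))
    from (j , t) = fromℕ< (≤-<-trans (s≤s⁻¹ (toℕ<n j)) I<n) ,
       ∧T (dec-T (_ ≤? I) (subst (_≤ I) (sym (toℕ-fromℕ< _)) (s≤s⁻¹ (toℕ<n j))))
          (subst (T ∘ P) (sym (toℕ-fromℕ< _)) t)
    tf : ∀ s → to (from s) ≡ s
    tf (j , t) = Sub-≡ (toℕ-injective (trans (toℕ-fromℕ< _) (toℕ-fromℕ< _)))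
    ft : ∀ s → from (to s) ≡ s
    ft (j , t) = Sub-≡ (toℕ-injective (trans (toℕ-fromℕ< _) (toℕ-fromℕ< _)))

  ≡↔ : ∀ {A B : Set} → A ≡ B → A ↔ B
  ≡↔ refl = ↔-refl

  module GaussSum (n' : ℕ) where
    open ReducedFractions n'

    φ∣ : Fin n → ℕ
    φ∣ i = if ⌊ suc (toℕ i) ∣? n ⌋ then φ (suc (toℕ i)) else 0

    card-isReduced : ∀ i → Card (Sub (Fin n) (isReduced i)) (φ∣ i)
    card-isReduced i with suc (toℕ i) ∣? n
    ... | no _ = card-empty (λ { (_ , ()) })
    ... | yes _ = card-resp (↔-sym (restrict-Fin (toℕ i) (toℕ<n i) (λ J → ⌊ coprime? (suc J) (suc (toℕ i)) ⌋))) (card-φ (suc (toℕ i)))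

    sum-gcd≡sum-φ : ∀ (F : ℕ → ℕ) → sumFin n (λ k → F (gcd (toℕ k) n)) ≡ sumFin n (λ i → φ∣ i * F (n / suc (toℕ i)))
    sum-gcd≡sum-φ F = card-unique cL cR
      where
      B : Fin n → Set
      B i = Fin (F (n / suc (toℕ i)))
      cL : Card (Σ (Fin n) (λ k → Fin (F (gcd (toℕ k) n)))) (sumFin n (λ k → F (gcd (toℕ k) n)))
      cL = card-ΣFin n _ _ (λ _ → ↔-refl)
      reassoc : Σ ReducedFraction (λ s → B (proj₁ (proj₁ s))) ↔ Σ (Fin n) (λ i → Σ (Sub (Fin n) (isReduced i)) (λ _ → B i))
      reassoc = mk↔ₛ′ (λ { (((i , j) , t) , x) → i , (j , t) , x }) (λ { (i , (j , t) , x) → ((i , j) , t) , x })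
                  (λ _ → refl) (λ _ → refl)
      iso : Σ (Fin n) (λ k → Fin (F (gcd (toℕ k) n))) ↔ Σ (Fin n) (λ i → Σ (Sub (Fin n) (isReduced i)) (λ _ → B i))
      iso = ↔-trans (Σ-↔ Fin↔ReducedFraction (λ {k} → ≡↔ (cong (Fin ∘ F) (gcd-reduce k)))) reassoc
      cR : Card (Σ (Fin n) (λ k → Fin (F (gcd (toℕ k) n)))) (sumFin n (λ i → φ∣ i * F (n / suc (toℕ i))))
      cR = card-resp (↔-sym iso) (card-ΣFin n _ _ (λ i →
             subst (Card _) (sumFin-const (φ∣ i) _) (card-Σ (card-isReduced i) (λ _ → B i) (λ _ → F (n / suc (toℕ i))) (λ _ → ↔-refl))))


module DivisorSum where

  open Cardinality
  open DistinctVectors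
  open ShiftClosedCount
  open GcdClasses
  open import Defs using (φ; sumDivisors)
  open import Data.Nat using (ℕ; zero; suc; _+_; _*_; _∸_; _≤_; NonZero; _/_; _!)
  open import Data.Nat.Properties
  open import Data.Nat.DivMod using (m*n/n≡m)
  open import Data.Nat.Divisibility using (_∣_; _∣?_; divides; ∣-trans; ∣⇒≤)
  open import Data.Nat.GCD using (gcd; gcd[m,n]∣m; gcd[m,n]∣n; gcd-greatest; gcd[m,n]≡0⇒m≡0)
  open import Data.Nat.Combinatorics using (_C_)
  open import Data.Fin using (Fin; zero; suc; toℕ)
  open import Data.Empty using (⊥-elim)
  open import Data.Bool using (if_then_else_)
  open import Data.List using (upTo)
  open import Function using (_∘_; id)
  open import Relation.Nullary using (Dec; yes; no; ¬_; does)
  open import Relation.Binary.PropositionalEquality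

  sumFin-* : ∀ k c (f : Fin k → ℕ) → sumFin k (λ i → c * f i) ≡ c * sumFin k f
  sumFin-* zero c f = sym (*-zeroʳ c)
  sumFin-* (suc k) c f = trans (cong (c * f zero +_) (sumFin-* k c (f ∘ suc))) 
      (sym (*-distribˡ-+ c (f zero) _))

  sumFin-+ : ∀ a b (f : ℕ → ℕ) → sumFin (a + b) (f ∘ toℕ) ≡ sumFin a (f ∘ toℕ) + sumFin b (λ i → f (a + toℕ i))
  sumFin-+ zero b f = refl
  sumFin-+ (suc a) b f = trans (cong (f 0 +_) (sumFin-+ a b (f ∘ suc))) (sym (+-assoc (f 0) _ _))

  sumFin-zero : ∀ b (f : Fin b → ℕ) → (∀ i → f i ≡ 0) → sumFin b f ≡ 0
  sumFin-zero b f h = trans (sumFin-cong b f (λ _ → 0) h) (trans (sumFin-const b 0) (*-zeroʳ b))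

  if-no : ∀ {P : Set} (d : Dec P) (a : ℕ) → ¬ P → (if does d then a else 0) ≡ 0
  if-no (yes p) a ¬p = ⊥-elim (¬p p)
  if-no (no _) a ¬p = refl

  if-yes : ∀ {P : Set} (d : Dec P) (a : ℕ) → P → (if does d then a else 0) ≡ a
  if-yes (yes _) a p = refl
  if-yes (no ¬p) a p = ⊥-elim (¬p p)

  module RightHandSide (n' m : ℕ) where
    open ShiftClosedVectors n' m using (countForPeriod; countForGcd)
    open GaussSum n' using (sum-gcd≡sum-φ; φ∣)
    n : ℕ
    n = suc n'
    G : ℕ
    G = gcd n m

    f : (d : ℕ) → .{{_ : NonZero d}} → ℕ
    f d = φ d * ((n / d) C (m / d))

    divisorTerm : ℕ → ℕ
    divisorTerm x = if does (suc x ∣? G) then f (suc x) else 0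

    sumDivisors≡sumFin : sumDivisors G f ≡ sumFin G (divisorTerm ∘ toℕ)
    sumDivisors≡sumFin = trans (sum-filter (λ k → suc k ∣? G) (λ k → f (suc k)) (upTo G))
                      (sum-applyUpTo divisorTerm id G)

    G≢0 : G ≢ 0
    G≢0 e = 0≢1+n (sym (gcd[m,n]≡0⇒m≡0 {n} {m} e))

    divisorTerm-large : ∀ x → G ≤ x → divisorTerm x ≡ 0
    divisorTerm-large x le = if-no (suc x ∣? G) (f (suc x)) (λ p → <⇒≱ (s≤s le) (∣⇒≤ {{nz}} p))
      where
      open import Data.Nat using (s≤s)
      nz : NonZero G
      nz with G | G≢0
      ... | zero | h = ⊥-elim (h refl)
      ... | suc _ | _ = _

    G≤n : G ≤ n
    G≤n = ∣⇒≤ (gcd[m,n]∣m n m)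

    sumFin-restrict : sumFin n (divisorTerm ∘ toℕ) ≡ sumFin G (divisorTerm ∘ toℕ)
    sumFin-restrict = begin
        sumFin n (divisorTerm ∘ toℕ)
      ≡⟨ cong (λ z → sumFin z (divisorTerm ∘ toℕ)) (sym (m+[n∸m]≡n G≤n)) ⟩
        sumFin (G + (n ∸ G)) (divisorTerm ∘ toℕ)
      ≡⟨ sumFin-+ G (n ∸ G) divisorTerm ⟩
        sumFin G (divisorTerm ∘ toℕ) + sumFin (n ∸ G) (λ i → divisorTerm (G + toℕ i))
      ≡⟨ cong (sumFin G (divisorTerm ∘ toℕ) +_) (sumFin-zero (n ∸ G) _ (λ i → divisorTerm-large (G + toℕ i) (m≤m+n G (toℕ i)))) ⟩
        sumFin G (divisorTerm ∘ toℕ) + 0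
      ≡⟨ +-identityʳ _ ⟩
        sumFin G (divisorTerm ∘ toℕ) ∎
      where open ≡-Reasoning

    countForGcd-divisor : ∀ d' → suc d' ∣ n → countForGcd (n / suc d') ≡ countForPeriod (suc d')
    countForGcd-divisor d' (divides q eq) = countForGcd-at (n / suc d') refl
      where
      countForGcd-at : ∀ c → n / suc d' ≡ c → countForGcd c ≡ countForPeriod (suc d')
      countForGcd-at zero e = ⊥-elim (0≢1+n (sym (trans eq (cong (_* suc d') (trans (sym (m*n/n≡m q (suc d'))) (trans (cong (_/ suc d') (sym eq)) e))))))
      countForGcd-at (suc c') e = cong countForPeriod (trans (cong (_/ suc c') eq') (m*n/n≡m (suc d') (suc c')))
        where
        eq' : n ≡ suc d' * suc c'
        eq' = trans eq (trans (*-comm q (suc d')) (cong (suc d' *_) (trans (sym (m*n/n≡m q (suc d'))) (trans (cong (_/ suc d') (sym eq)) e))))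

    gauss-term : ∀ (i : Fin n) → φ∣ i * countForGcd (n / suc (toℕ i)) ≡ m ! * divisorTerm (toℕ i)
    gauss-term i with suc (toℕ i) ∣? n
    ... | no ¬a = sym (trans (cong (m ! *_) u0) (*-zeroʳ (m !)))
      where
      u0 : divisorTerm (toℕ i) ≡ 0
      u0 = if-no (suc (toℕ i) ∣? G) _ (λ p → ¬a (∣-trans p (gcd[m,n]∣m n m)))
    ... | yes a = trans (cong (φ (suc (toℕ i)) *_) (countForGcd-divisor (toℕ i) a)) (countForPeriod-term)
      where
      D : ℕ
      D = suc (toℕ i)
      countForPeriod-term : φ D * countForPeriod D ≡ m ! * divisorTerm (toℕ i)
      countForPeriod-term with D ∣? m
      ... | no ¬b = trans (*-zeroʳ (φ D)) (sym (trans (cong (m ! *_) u0) (*-zeroʳ (m !))))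
        where
        u0 : divisorTerm (toℕ i) ≡ 0
        u0 = if-no (D ∣? G) _ (λ p → ¬b (∣-trans p (gcd[m,n]∣n n m)))
      ... | yes b = trans (rng (φ D) ((n / D) C (m / D)) (m !)) (cong (m ! *_) (sym u1))
        where
        rng : ∀ x y z → x * (y * z) ≡ z * (x * y)
        rng x y z = trans (sym (*-assoc x y z)) (*-comm (x * y) z)
        u1 : divisorTerm (toℕ i) ≡ φ D * ((n / D) C (m / D))
        u1 = if-yes (D ∣? G) _ (gcd-greatest a b)

    sum-countForGcd≡rhs : sumFin n (λ k → countForGcd (gcd (toℕ k) n)) ≡ m ! * sumDivisors G f
    sum-countForGcd≡rhs = begin
        sumFin n (λ k → countForGcd (gcd (toℕ k) n))
      ≡⟨ sum-gcd≡sum-φ countForGcd ⟩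
        sumFin n (λ i → φ∣ i * countForGcd (n / suc (toℕ i)))
      ≡⟨ sumFin-cong n _ _ gauss-term ⟩
        sumFin n (λ i → m ! * divisorTerm (toℕ i))
      ≡⟨ sumFin-* n (m !) (divisorTerm ∘ toℕ) ⟩
        m ! * sumFin n (divisorTerm ∘ toℕ)
      ≡⟨ cong (m ! *_) (trans sumFin-restrict (sym sumDivisors≡sumFin)) ⟩
        m ! * sumDivisors G f ∎
      where open ≡-Reasoning


module FieldArithmetic where

  open Cardinality
  open DistinctVectors
  open import Defs using (FiniteField)
  open import Data.Nat as ℕ using (ℕ; zero; suc)
  import Data.Nat.Properties as NP
  open import Data.Nat.DivMod using (_%_; _/_; m≡m%n+[m/n]*n; m%n<n)
  open import Data.Nat.Divisibility using (_∣_; m%n≡0⇒n∣m)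
  open import Relation.Binary.Definitions using (tri<; tri≈; tri>)
  open import Data.Fin using (Fin; zero; suc; punchIn; punchOut; toℕ; fromℕ; fromℕ<)
  open import Data.Fin.Properties
    using (punchInᵢ≢i; punchIn-punchOut; punchOut-punchIn; punchOut-cong; suc-injective; toℕ-fromℕ; toℕ-fromℕ<; toℕ-injective; toℕ<n; any?)
    renaming (_≟_ to _≟F_)
  open import Data.Empty using (⊥; ⊥-elim)
  open import Data.Bool using (Bool; T; not)
  open import Data.Product using (Σ; ∃; _×_; _,_; proj₁; proj₂)
  open import Function using (_∘_)
  open import Function.Bundles using (Inverse; mk↔ₛ′)
  open import Function.Properties.Inverse using (↔-sym)
  open import Relation.Nullary using (Dec; yes; no; ¬_)
  open import Relation.Nullary.Decidable using (⌊_⌋; map′)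
  open import Relation.Binary.Definitions using (DecidableEquality)
  open import Relation.Binary.PropositionalEquality
  open import Algebra.Structures using (IsCommutativeRing)
  import Algebra.Properties.CommutativeMonoid.Sum
  import Algebra.Solver.CommutativeMonoid
  import Algebra.Properties.Group

  module Field (n' : ℕ) (F : FiniteField (suc (suc n'))) where
    open FiniteField F public
    open IsCommutativeRing isCommutativeRing public
      using (*-comm; *-assoc; *-identityˡ; *-identityʳ; zeroˡ; zeroʳ; distribˡ; distribʳ; +-identityˡ; +-identityʳ; +-assoc; +-comm; -‿inverseʳ; -‿inverseˡ)

    n : ℕ
    n = suc n'
    q : ℕ
    q = suc n

    _≟_ : DecidableEquality Carrier
    x ≟ y = map′ (Inverse-to-injective (↔-sym enum)) (cong (Inverse.from enum)) (Inverse.from enum x ≟F Inverse.from enum y)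

    isNonzero : Carrier → Bool
    isNonzero x = not ⌊ x ≟ 0# ⌋

    Nonzero : Set
    Nonzero = Sub Carrier isNonzero

    nonzero⇒T : ∀ {x} → x ≢ 0# → T (isNonzero x)
    nonzero⇒T {x} h = dec-Tnot (x ≟ 0#) h

    T⇒nonzero : ∀ {x} → T (isNonzero x) → x ≢ 0#
    T⇒nonzero {x} t = Tnot-dec (x ≟ 0#) t

    a0 : Fin q
    a0 = Inverse.from enum 0#

    card-Nonzero : Card Nonzero n
    card-Nonzero = mk↔ₛ′ to' from' tf ft
      where
      ne : ∀ i → Inverse.to enum (punchIn a0 i) ≢ 0#
      ne i e = punchInᵢ≢i a0 i (trans (sym (Inverse.strictlyInverseʳ enum (punchIn a0 i))) (cong (Inverse.from enum) e))
      to' : Fin n → Nonzero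
      to' i = Inverse.to enum (punchIn a0 i) , nonzero⇒T (ne i)
      ne2 : ∀ (s : Nonzero) → a0 ≢ Inverse.from enum (proj₁ s)
      ne2 (x , t) e = T⇒nonzero t (Inverse-to-injective (↔-sym enum) (sym e))
      from' : Nonzero → Fin n
      from' s = punchOut (ne2 s)
      tf : ∀ s → to' (from' s) ≡ s
      tf s = Sub-≡ (trans (cong (Inverse.to enum) (punchIn-punchOut (ne2 s))) (Inverse.strictlyInverseˡ enum (proj₁ s)))
      ft : ∀ i → from' (to' i) ≡ i
      ft i = trans (punchOut-cong a0 (Inverse.strictlyInverseʳ enum (punchIn a0 i))) (punchOut-punchIn a0)

    open ≡-Reasoning

    inv : (x : Carrier) → x ≢ 0# → Carrier
    inv x h = proj₁ (inverse x h)

    inv-r : ∀ x (h : x ≢ 0#) → x * inv x h ≡ 1#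
    inv-r x h = proj₂ (inverse x h)

    cancelʳ : ∀ {a b c} → c ≢ 0# → a * c ≡ b * c → a ≡ b
    cancelʳ {a} {b} {c} h e = begin
        a                  ≡⟨ sym (*-identityʳ a) ⟩
        a * 1#             ≡⟨ cong (a *_) (sym (inv-r c h)) ⟩
        a * (c * inv c h)  ≡⟨ sym (*-assoc a c _) ⟩
        (a * c) * inv c h  ≡⟨ cong (_* inv c h) e ⟩
        (b * c) * inv c h  ≡⟨ *-assoc b c _ ⟩
        b * (c * inv c h)  ≡⟨ cong (b *_) (inv-r c h) ⟩
        b * 1#             ≡⟨ *-identityʳ b ⟩
        b ∎

    cancelˡ : ∀ {a b c} → c ≢ 0# → c * a ≡ c * b → a ≡ b
    cancelˡ {a} {b} {c} h e = cancelʳ h (trans (*-comm a c) (trans e (*-comm c b)))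

    zero-prod : ∀ {x y} → x ≢ 0# → x * y ≡ 0# → y ≡ 0#
    zero-prod {x} {y} h e = cancelˡ h (trans e (sym (zeroʳ x)))

    mul-nz : ∀ {x y} → x ≢ 0# → y ≢ 0# → x * y ≢ 0#
    mul-nz hx hy e = hy (zero-prod hx e)

    1≢0 : 1# ≢ 0#
    1≢0 e = 0≢1 (sym e)

    pow : Carrier → ℕ → Carrier
    pow x zero = 1#
    pow x (suc k) = x * pow x k

    pow-+ : ∀ x a b → pow x (a ℕ.+ b) ≡ pow x a * pow x b
    pow-+ x zero b = sym (*-identityˡ _)
    pow-+ x (suc a) b = trans (cong (x *_) (pow-+ x a b)) (sym (*-assoc x _ _))

    pow-1 : ∀ k → pow 1# k ≡ 1#
    pow-1 zero = refl
    pow-1 (suc k) = trans (*-identityˡ _) (pow-1 k)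

    pow-* : ∀ x a b → pow x (a ℕ.* b) ≡ pow (pow x a) b
    pow-* x zero b = sym (pow-1 b)
    pow-* x (suc a) b = begin
        pow x (b ℕ.+ a ℕ.* b)
      ≡⟨ pow-+ x b (a ℕ.* b) ⟩
        pow x b * pow x (a ℕ.* b)
      ≡⟨ cong (pow x b *_) (pow-* x a b) ⟩
        pow x b * pow (pow x a) b
      ≡⟨ sym (pow-mul x (pow x a) b) ⟩
        pow (x * pow x a) b ∎
      where
      pow-mul : ∀ x y k → pow (x * y) k ≡ pow x k * pow y k
      pow-mul x y zero = sym (*-identityˡ 1#)
      pow-mul x y (suc k) = begin
          (x * y) * pow (x * y) k
        ≡⟨ cong ((x * y) *_) (pow-mul x y k) ⟩
          (x * y) * (pow x k * pow y k)
        ≡⟨ *-assoc x y _ ⟩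
          x * (y * (pow x k * pow y k))
        ≡⟨ cong (x *_) (trans (sym (*-assoc y _ _)) (trans (cong (_* pow y k) (*-comm y (pow x k))) (*-assoc (pow x k) y _))) ⟩
          x * (pow x k * (y * pow y k))
        ≡⟨ sym (*-assoc x _ _) ⟩
          (x * pow x k) * (y * pow y k) ∎

    pow-nz : ∀ {x} k → x ≢ 0# → pow x k ≢ 0#
    pow-nz zero h = 1≢0
    pow-nz (suc k) h = mul-nz h (pow-nz k h)

    open import Algebra.Bundles using (CommutativeMonoid)
    *-CM : CommutativeMonoid _ _
    *-CM = record { isCommutativeMonoid = IsCommutativeRing.*-isCommutativeMonoid isCommutativeRing }
    module Π = Algebra.Properties.CommutativeMonoid.Sum *-CM
    open import Data.Fin.Permutation using (Permutation)

    e : Fin n → Carrier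
    e i = proj₁ (Inverse.to card-Nonzero i)

    enumNonzero-nonzero : ∀ i → e i ≢ 0#
    enumNonzero-nonzero i = T⇒nonzero (proj₂ (Inverse.to card-Nonzero i))

    enumNonzero-from : ∀ (s : Nonzero) → e (Inverse.from card-Nonzero s) ≡ proj₁ s
    enumNonzero-from s = cong proj₁ (Inverse.strictlyInverseˡ card-Nonzero s)

    from-enumNonzero : ∀ (s : Nonzero) i → proj₁ s ≡ e i → Inverse.from card-Nonzero s ≡ i
    from-enumNonzero (a , t) i p = trans (cong (Inverse.from card-Nonzero)
        (Sub-≡ {b = isNonzero} {t = t} {t' = proj₂ (Inverse.to card-Nonzero i)} p)) (Inverse.strictlyInverseʳ card-Nonzero i)

    product-nonzero : ∀ k (f : Fin k → Carrier) → (∀ i → f i ≢ 0#) → Π.sum f ≢ 0#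
    product-nonzero zero f h = 1≢0
    product-nonzero (suc k) f h = mul-nz (h zero) (product-nonzero k (f ∘ suc) (h ∘ suc))

    product-const : ∀ k x → Π.sum {k} (λ _ → x) ≡ pow x k
    product-const zero x = refl
    product-const (suc k) x = cong (x *_) (product-const k x)

    fermat : ∀ x → x ≢ 0# → pow x n ≡ 1#
    fermat x hx = sym (cancelʳ (product-nonzero n e enumNonzero-nonzero) (trans (*-identityˡ (Π.sum {n} e)) eq))
      where
      xi : Carrier
      xi = inv x hx
      xi-nz : xi ≢ 0#
      xi-nz h = 1≢0 (trans (sym (inv-r x hx)) (trans (cong (x *_) h) (zeroʳ x)))
      sf : Fin n → Nonzero
      sf i = x * e i , nonzero⇒T (mul-nz hx (enumNonzero-nonzero i))
      sb : Fin n → Nonzero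
      sb i = xi * e i , nonzero⇒T (mul-nz xi-nz (enumNonzero-nonzero i))
      πf : Fin n → Fin n
      πf i = Inverse.from card-Nonzero (sf i)
      πb : Fin n → Fin n
      πb i = Inverse.from card-Nonzero (sb i)
      π : Permutation n n
      π = mk↔ₛ′ πf πb
                (λ i → from-enumNonzero (sf (πb i)) i (trans (cong (x *_) (enumNonzero-from (sb i)))
                          (trans (sym (*-assoc x xi (e i))) (trans (cong (_* e i) (inv-r x hx)) (*-identityˡ (e i))))))
                (λ i → from-enumNonzero (sb (πf i)) i (trans (cong (xi *_) (enumNonzero-from (sf i)))
                          (trans (sym (*-assoc xi x (e i))) (trans (cong (_* e i) (trans (*-comm xi x) (inv-r x hx))) (*-identityˡ (e i))))))
      eq : Π.sum {n} e ≡ pow x n * Π.sum {n} e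
      eq = begin
          Π.sum {n} e
        ≡⟨ Π.sum-permute {n} {n} e π ⟩
          Π.sum {n} (λ i → e (πf i))
        ≡⟨ Π.sum-cong-≗ (λ i → enumNonzero-from (sf i)) ⟩
          Π.sum {n} (λ i → x * e i)
        ≡⟨ Π.∑-distrib-+ {n} (λ _ → x) e ⟩
          Π.sum {n} (λ _ → x) * Π.sum {n} e
        ≡⟨ cong (_* Π.sum {n} e) (product-const n x) ⟩
          pow x n * Π.sum {n} e ∎

    least-witness : ∀ {k} (P : Fin k → Set) → (∀ i → Dec (P i)) → ∃ P →
            Σ (Fin k) (λ i → P i × (∀ j → toℕ j ℕ.< toℕ i → ¬ P j))
    least-witness {suc k} P P? ex with P? zero
    ... | yes p = zero , p , λ j ()
    ... | no ¬p with ex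
    ...   | zero , pz = ⊥-elim (¬p pz)
    ...   | suc i , pi with least-witness (P ∘ suc) (P? ∘ suc) (i , pi)
    ...     | j , pj , h = suc j , pj , λ { zero _ → ¬p ; (suc j') (ℕ.s≤s lt) → h j' lt }

    nz : Nonzero → Carrier
    nz = proj₁

    nonzero-value : ∀ (s : Nonzero) → proj₁ s ≢ 0#
    nonzero-value (x , t) = T⇒nonzero t

    abstract
      order-witness : (s : Nonzero) → Σ (Fin n) (λ i → pow (proj₁ s) (suc (toℕ i)) ≡ 1# × (∀
          (j : Fin n) → toℕ j ℕ.< toℕ i → ¬ (pow (proj₁ s) (suc (toℕ j)) ≡ 1#)))
      order-witness s = least-witness (λ i → pow (proj₁ s) (suc (toℕ i)) ≡ 1#) (λ i → pow (proj₁ s) (suc (toℕ i)) ≟ 1#)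
                 (fromℕ n' , subst (λ z → pow (proj₁ s) (suc z) ≡ 1#) (sym
                     (toℕ-fromℕ n')) (fermat (proj₁ s) (nonzero-value s)))

    ordIndex : Nonzero → Fin n
    ordIndex s = proj₁ (order-witness s)

    ord : Nonzero → ℕ
    ord s = suc (toℕ (ordIndex s))

    pow-ord≡1 : ∀ s → pow (proj₁ s) (ord s) ≡ 1#
    pow-ord≡1 s = proj₁ (proj₂ (order-witness s))

    ord-min : ∀ s t → 0 ℕ.< t → t ℕ.< ord s → pow (proj₁ s) t ≢ 1#
    ord-min s (suc t) _ (ℕ.s≤s lt) e = proj₂ (proj₂ (order-witness s)) j
        (subst (ℕ._< toℕ (ordIndex s)) (sym (toℕ-fromℕ< tl)) lt)
        (subst (λ z → pow (proj₁ s) (suc z) ≡ 1#) (sym (toℕ-fromℕ< tl)) e)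
      where
      tl : t ℕ.< n
      tl = NP.<-trans lt (toℕ<n (ordIndex s))
      j : Fin n
      j = fromℕ< tl

    pow-dvd : ∀ x r k → pow x r ≡ 1# → pow x (k ℕ.* r) ≡ 1#
    pow-dvd x r k e = trans (cong (pow x) (NP.*-comm k r)) (trans (pow-* x r k) (trans (cong (λ z → pow z k) e) (pow-1 k)))

    ord∣ : ∀ s a → pow (proj₁ s) a ≡ 1# → ord s ∣ a
    ord∣ s a e = m%n≡0⇒n∣m a (ord s) remainder-zero
      where
      x : Carrier
      x = proj₁ s
      r : ℕ
      r = ord s
      x^[a%r]≡1 : pow x (a % r) ≡ 1#
      x^[a%r]≡1 = begin
          pow x (a % r)
        ≡⟨ sym (*-identityʳ _) ⟩
          pow x (a % r) * 1#
        ≡⟨ cong (pow x (a % r) *_) (sym (pow-dvd x r (a / r) (pow-ord≡1 s))) ⟩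
          pow x (a % r) * pow x (a / r ℕ.* r)
        ≡⟨ sym (pow-+ x (a % r) _) ⟩
          pow x (a % r ℕ.+ a / r ℕ.* r)
        ≡⟨ cong (pow x) (sym (m≡m%n+[m/n]*n a r)) ⟩
          pow x a
        ≡⟨ e ⟩
          1# ∎
      remainder-zero : a % r ≡ 0
      remainder-zero with a % r in eq
      ... | zero = refl
      ... | suc t = ⊥-elim (ord-min s (suc t) (ℕ.s≤s ℕ.z≤n) (subst (ℕ._< r) eq (m%n<n a r)) (subst (λ z → pow x z ≡ 1#) eq x^[a%r]≡1))

    ord∣n : ∀ s → ord s ∣ n
    ord∣n s = ord∣ s n (fermat (proj₁ s) (nonzero-value s))

    pow-injective-< : ∀ s i j → i ℕ.< j → j ℕ.< ord s → pow (proj₁ s) i ≡ pow (proj₁ s) j → ⊥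
    pow-injective-< s i j lt lj e = ord-min s (j ℕ.∸ i) (NP.m<n⇒0<n∸m lt) (NP.≤-<-trans (NP.m∸n≤m j i) lj) (sym x^[j-i]≡1)
      where
      x : Carrier
      x = proj₁ s
      x^i≡x^i*x^[j-i] : pow x i * 1# ≡ pow x i * pow x (j ℕ.∸ i)
      x^i≡x^i*x^[j-i] = trans (*-identityʳ (pow x i)) (trans e (trans (cong (pow x) (sym (NP.m+[n∸m]≡n (NP.<⇒≤ lt)))) (pow-+ x i (j ℕ.∸ i))))
      x^[j-i]≡1 : 1# ≡ pow x (j ℕ.∸ i)
      x^[j-i]≡1 = cancelˡ (pow-nz i (nonzero-value s)) x^i≡x^i*x^[j-i]

    pow-distinct : ∀ s i j → i ℕ.< ord s → j ℕ.< ord s → pow (proj₁ s) i ≡ pow (proj₁ s) j → i ≡ j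
    pow-distinct s i j li lj e with NP.<-cmp i j
    ... | tri< i<j _ _ = ⊥-elim (pow-injective-< s i j i<j lj e)
    ... | tri≈ _ i≡j _ = i≡j
    ... | tri> _ _ j<i = ⊥-elim (pow-injective-< s j i j<i li (sym e))

    open import Data.Vec using (Vec; []; _∷_; lookup)
    open import Algebra.Bundles using (CommutativeMonoid; Group)
    +-commutativeMonoid : CommutativeMonoid _ _
    +-commutativeMonoid = record { isCommutativeMonoid = IsCommutativeRing.+-isCommutativeMonoid isCommutativeRing }
    module +-Solver = Algebra.Solver.CommutativeMonoid +-commutativeMonoid
    +-group : Group _ _
    +-group = record { isGroup = IsCommutativeRing.+-isGroup isCommutativeRing }
    module +-Group = Algebra.Properties.Group +-group

    eval : ∀ {k} → Vec Carrier k → Carrier → Carrier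
    eval [] x = 0#
    eval (c ∷ p) x = c + x * eval p x

    divide : ∀ {k} → Carrier → Vec Carrier (suc k) → Vec Carrier k × Carrier
    divide a (c ∷ []) = [] , c
    divide a (c ∷ c' ∷ p) = (proj₂ (divide a (c' ∷ p)) ∷ proj₁ (divide a (c' ∷ p))) , c + a * proj₂ (divide a (c' ∷ p))

    eval-divide : ∀ {k} a (p : Vec Carrier (suc k)) x → eval p x ≡ (x + - a) * eval (proj₁ (divide a p)) x + proj₂ (divide a p)
    eval-divide a (c ∷ []) x = begin
        c + x * 0#
      ≡⟨ cong (c +_) (zeroʳ x) ⟩
        c + 0#
      ≡⟨ +-comm c 0# ⟩
        0# + c
      ≡⟨ cong (_+ c) (sym (zeroʳ _)) ⟩
        (x + - a) * 0# + c ∎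
    eval-divide a (c ∷ c' ∷ p) x = begin
        c + x * eval (c' ∷ p) x
      ≡⟨ cong (λ z → c + x * z) (eval-divide a (c' ∷ p) x) ⟩
        c + x * (d * Q + r')
      ≡⟨ cong (c +_) (distribˡ x (d * Q) r') ⟩
        c + (x * (d * Q) + x * r')
      ≡⟨ sym (+-identityʳ _) ⟩
        (c + (x * (d * Q) + x * r')) + 0#
      ≡⟨ cong ((c + (x * (d * Q) + x * r')) +_) (sym BE0) ⟩
        (c + (x * (d * Q) + x * r')) + ((- a) * r' + a * r')
      ≡⟨ +-Solver.solve 5 (λ A B C D E → (D +-Solver.⊕ (C +-Solver.⊕ A)) +-Solver.⊕ (B +-Solver.⊕ E) +-Solver.⊜
          ((A +-Solver.⊕ B) +-Solver.⊕ C) +-Solver.⊕ (D +-Solver.⊕ E)) refl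
           (x * r') ((- a) * r') (x * (d * Q)) c (a * r') ⟩
        ((x * r' + (- a) * r') + x * (d * Q)) + (c + a * r')
      ≡⟨ cong₂ (λ u v → (u + v) + (c + a * r')) (sym (distribʳ r' x (- a))) xdQ ⟩
        (d * r' + d * (x * Q)) + (c + a * r')
      ≡⟨ cong (_+ (c + a * r')) (sym (distribˡ d r' (x * Q))) ⟩
        d * (r' + x * Q) + (c + a * r') ∎
      where
      d : Carrier
      d = x + - a
      Q : Carrier
      Q = eval (proj₁ (divide a (c' ∷ p))) x
      r' : Carrier
      r' = proj₂ (divide a (c' ∷ p))
      BE0 : (- a) * r' + a * r' ≡ 0#
      BE0 = trans (sym (distribʳ r' (- a) a)) (trans (cong (_* r') (-‿inverseˡ a)) (zeroˡ r'))
      xdQ : x * (d * Q) ≡ d * (x * Q)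
      xdQ = trans (sym (*-assoc x d Q)) (trans (cong (_* Q) (*-comm x d)) (*-assoc d x Q))

    divide-zero : ∀ {k} a (p : Vec Carrier (suc k)) → (∀ i → lookup (proj₁ (divide a p)) i ≡ 0#) → proj₂ (divide a p) ≡ 0# →
               ∀ i → lookup p i ≡ 0#
    divide-zero a (c ∷ []) hq hr zero = hr
    divide-zero a (c ∷ c' ∷ p) hq hr zero = trans (sym (+-identityʳ c)) (trans (cong (c +_) (sym (trans (cong (a *_) (hq zero)) (zeroʳ a)))) hr)
    divide-zero a (c ∷ c' ∷ p) hq hr (suc i) = divide-zero a (c' ∷ p) (hq ∘ suc) (hq zero) i

    remainder≡eval : ∀ {k} a (p : Vec Carrier (suc k)) → proj₂ (divide a p) ≡ eval p a
    remainder≡eval a p = begin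
      r                          ≡⟨ sym (+-identityˡ r) ⟩
      0# + r                     ≡⟨ cong (_+ r) (sym (trans (cong (_* eval quo a) (-‿inverseʳ a)) (zeroˡ _))) ⟩
      (a + - a) * eval quo a + r   ≡⟨ sym (eval-divide a p a) ⟩
      eval p a                   ∎
      where
      quo = proj₁ (divide a p)
      r : Carrier
      r = proj₂ (divide a p)

    roots⇒zero-coefficients : ∀ k (p : Vec Carrier k) (r : Fin k → Carrier) → (∀ {i j} → r i ≡ r j → i ≡ j) →
                (∀ i → eval p (r i) ≡ 0#) → ∀ i → lookup p i ≡ 0#
    roots⇒zero-coefficients (suc k) p r r-injective roots = divide-zero a p quotient-zero remainder-zero
      where
      a : Carrier
      a = r zero
      quo = proj₁ (divide a p)
      remainder-zero : proj₂ (divide a p) ≡ 0#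
      remainder-zero = trans (remainder≡eval a p) (roots zero)
      factor-nonzero : ∀ i → r (suc i) + - a ≢ 0#
      factor-nonzero i h = 0≢suc (r-injective (+-Group.x∙y⁻¹≈ε⇒x≈y (r (suc i)) a h))
        where
        0≢suc : ∀ {k} {j : Fin k} → suc j ≢ zero
        0≢suc ()
      quotient-roots : ∀ i → eval quo (r (suc i)) ≡ 0#
      quotient-roots i = zero-prod (factor-nonzero i)
        (trans (sym (+-identityʳ X)) (trans (cong (X +_) (sym remainder-zero))
          (trans (sym (eval-divide a p (r (suc i)))) (roots (suc i)))))
        where
        X : Carrier
        X = (r (suc i) + - a) * eval quo (r (suc i))
      quotient-zero : ∀ i → lookup quo i ≡ 0#
      quotient-zero = roots⇒zero-coefficients k quo (r ∘ suc) (suc-injective ∘ r-injective) quotient-roots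

    monomial : ∀ k → Vec Carrier (suc k)
    monomial zero = 1# ∷ []
    monomial (suc k) = 0# ∷ monomial k

    eval-monomial : ∀ k x → eval (monomial k) x ≡ pow x k
    eval-monomial zero x = trans (cong (1# +_) (zeroʳ x)) (+-identityʳ 1#)
    eval-monomial (suc k) x = trans (+-identityˡ _) (cong (x *_) (eval-monomial k x))

    monomial-leading : ∀ k → lookup (monomial k) (fromℕ k) ≡ 1#
    monomial-leading zero = refl
    monomial-leading (suc k) = monomial-leading k

    no-root-outside-powers : ∀ (s : Nonzero) z → pow z (ord s) ≡ 1# → ¬ (∃ λ (j : Fin (ord s)) → pow (proj₁ s) (suc (toℕ j)) ≡ z) → ⊥
    no-root-outside-powers s z hz ¬h = 1≢0 (trans (sym (monomial-leading d')) (roots⇒zero-coefficients (suc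
        (suc d')) P r rinj roots (suc (fromℕ d'))))
      where
      y : Carrier
      y = proj₁ s
      d' : ℕ
      d' = toℕ (ordIndex s)
      P : Vec Carrier (suc (suc d'))
      P = (- 1#) ∷ monomial d'
      r : Fin (suc (ord s)) → Carrier
      r zero = z
      r (suc j) = pow y (suc (toℕ j))
      rinj : ∀ {i j} → r i ≡ r j → i ≡ j
      rinj {zero} {zero} _ = refl
      rinj {zero} {suc j} e = ⊥-elim (¬h (j , sym e))
      rinj {suc i} {zero} e = ⊥-elim (¬h (i , e))
      rinj {suc i} {suc j} e = cong suc (toℕ-injective
        (pow-distinct s (toℕ i) (toℕ j) (toℕ<n i) (toℕ<n j) (cancelˡ (nonzero-value s) e)))
      evalP : ∀ x → pow x (ord s) ≡ 1# → eval P x ≡ 0#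
      evalP x h = trans (cong (λ u → - 1# + x * u) (eval-monomial d' x)) (trans (cong (- 1# +_) h) (-‿inverseˡ 1#))
      roots : ∀ i → eval P (r i) ≡ 0#
      roots zero = evalP z hz
      roots (suc j) = evalP _ (trans (sym (pow-* y (suc (toℕ j)) (ord s)))
        (trans (cong (pow y) (NP.*-comm (suc (toℕ j)) (ord s))) (trans (pow-* y (ord s) (suc (toℕ j)))
          (trans (cong (λ u → pow u (suc (toℕ j))) (pow-ord≡1 s)) (pow-1 (suc (toℕ j)))))))

    abstract
      all-powers : ∀ (s : Nonzero) z → pow z (ord s) ≡ 1# → ∃ λ (j : Fin (ord s)) → pow (proj₁ s) (suc (toℕ j)) ≡ z
      all-powers s z hz = decided (any? (λ (j : Fin (ord s)) → pow (proj₁ s) (suc (toℕ j)) ≟ z))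
        where
        decided : Dec (∃ λ (j : Fin (ord s)) → pow (proj₁ s) (suc (toℕ j)) ≡ z) → ∃ λ (j : Fin (ord s)) → pow (proj₁ s) (suc (toℕ j)) ≡ z
        decided (yes found) = found
        decided (no ¬found) = ⊥-elim (no-root-outside-powers s z hz ¬found)


module PrimitiveElement where

  open Cardinality
  open DistinctVectors
  open FibreUnions using (partition-by)
  open FieldArithmetic
  open GcdClasses using (module GaussSum; coprimeTo; card-φ; quot; qeq)
  open import Defs using (FiniteField; φ)
  open import Data.Nat as ℕ using (ℕ; zero; suc; _≤_; _<_; z≤n; s≤s; ≢-nonZero)
  import Data.Nat.Properties as NP
  open import Data.Nat.Properties using (0≢1+n)
  open import Data.Nat.Divisibility using (_∣_; _∣?_; ∣-refl; ∣⇒≤)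
  open import Data.Nat.GCD using (gcd; gcd[m,n]∣m; gcd[m,n]∣n; gcd[m,n]≡0⇒n≡0; gcd-zeroˡ)
  open import Data.Nat.Coprimality using (Coprime; gcd≡1⇒coprime; coprime?)
  open import Data.Fin using (Fin; zero; suc; toℕ; fromℕ)
  open import Data.Fin.Properties using (toℕ-fromℕ) renaming (_≟_ to _≟F_)
  open import Data.Empty using (⊥-elim)
  open import Data.Unit using (tt)
  open import Data.Bool using (Bool; true; T; if_then_else_)
  open import Data.Product using (Σ; _,_; proj₁; proj₂)
  open import Function using (_∘_)
  open import Function.Bundles using (Inverse; _↔_; mk↔ₛ′)
  open import Function.Properties.Inverse using (↔-sym; ↔-trans)
  open import Relation.Nullary using (yes; no)
  open import Relation.Nullary.Decidable using (⌊_⌋)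
  open import Relation.Binary.PropositionalEquality

  sumFin-mono : ∀ k (a b : Fin k → ℕ) → (∀ i → a i ≤ b i) → sumFin k a ≤ sumFin k b
  sumFin-mono zero a b h = z≤n
  sumFin-mono (suc k) a b h = NP.+-mono-≤ (h zero) (sumFin-mono k (a ∘ suc) (b ∘ suc) (h ∘ suc))

  sumFin-strict : ∀ k (a b : Fin k → ℕ) → (∀ i → a i ≤ b i) → ∀ j → a j < b j → sumFin k a < sumFin k b
  sumFin-strict (suc k) a b h zero lt = NP.+-mono-<-≤ lt (sumFin-mono k (a ∘ suc) (b ∘ suc) (h ∘ suc))
  sumFin-strict (suc k) a b h (suc j) lt = NP.+-mono-≤-< (h zero) (sumFin-strict k (a ∘ suc) (b ∘ suc) (h ∘ suc) j lt)

  module OrderCount (n' : ℕ) (F : FiniteField (suc (suc n'))) where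
    open Field n' F
    open GaussSum n' using (φ∣; sum-gcd≡sum-φ)

    hasOrder : Fin n → Nonzero → Bool
    hasOrder i s = ⌊ ordIndex s ≟F i ⌋

    OfOrder : Fin n → Set
    OfOrder i = Sub Nonzero (hasOrder i)

    #OfOrder : Fin n → ℕ
    #OfOrder i = sumFin n (λ t → if hasOrder i (Inverse.to card-Nonzero t) then 1 else 0)

    card-OfOrder : ∀ i → Card (OfOrder i) (#OfOrder i)
    card-OfOrder i = card-Σ card-Nonzero (T ∘ hasOrder i) (λ s → if hasOrder i s then 1 else 0) (λ s → card-T (hasOrder i s))

    sum-#OfOrder : sumFin n #OfOrder ≡ n
    sum-#OfOrder = card-unique (card-resp iso (card-ΣFin n OfOrder #OfOrder card-OfOrder)) card-Nonzero
      where
      triv : Nonzero ↔ Sub Nonzero (λ _ → true)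
      triv = mk↔ₛ′ (λ s → s , tt) proj₁ (λ _ → refl) (λ _ → refl)
      iso : Σ (Fin n) OfOrder ↔ Nonzero
      iso = ↔-sym (↔-trans triv (partition-by (λ _ → true) ordIndex _≟F_))

    sum-φ∣ : sumFin n φ∣ ≡ n
    sum-φ∣ = sym (trans (sym (trans (sumFin-const n 1) (NP.*-identityʳ n)))
                 (trans (sum-gcd≡sum-φ (λ _ → 1)) (sumFin-cong n _ _ (λ i → NP.*-identityʳ (φ∣ i)))))

    ord-OfOrder : ∀ i (x : OfOrder i) → ord (proj₁ x) ≡ suc (toℕ i)
    ord-OfOrder i (x , t) = cong (suc ∘ toℕ) (T-dec (ordIndex x ≟F i) t)

    power-of-same-order⇒coprime : ∀ (y x : Nonzero) k → pow (proj₁ y) k ≡ proj₁ x → ord x ≡ ord y → Coprime k (ord y)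
    power-of-same-order⇒coprime y x k y^k≡x ordx≡d = gcd≡1⇒coprime g≡1
      where
      open ≡-Reasoning
      d : ℕ
      d = ord y
      g : ℕ
      g = gcd k d
      a : ℕ
      a = quot (gcd[m,n]∣m k d)
      b : ℕ
      b = quot (gcd[m,n]∣n k d)
      k≡ag : k ≡ a ℕ.* g
      k≡ag = qeq (gcd[m,n]∣m k d)
      d≡bg : d ≡ b ℕ.* g
      d≡bg = qeq (gcd[m,n]∣n k d)
      kb≡ad : k ℕ.* b ≡ a ℕ.* d
      kb≡ad = begin
        k ℕ.* b          ≡⟨ cong (ℕ._* b) k≡ag ⟩
        a ℕ.* g ℕ.* b    ≡⟨ NP.*-assoc a g b ⟩
        a ℕ.* (g ℕ.* b)  ≡⟨ cong (a ℕ.*_) (trans (NP.*-comm g b) (sym d≡bg)) ⟩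
        a ℕ.* d          ∎
      x^b≡1 : pow (proj₁ x) b ≡ 1#
      x^b≡1 = begin
        pow (proj₁ x) b         ≡⟨ cong (λ z → pow z b) (sym y^k≡x) ⟩
        pow (pow (proj₁ y) k) b ≡⟨ sym (pow-* (proj₁ y) k b) ⟩
        pow (proj₁ y) (k ℕ.* b) ≡⟨ cong (pow (proj₁ y)) kb≡ad ⟩
        pow (proj₁ y) (a ℕ.* d) ≡⟨ pow-dvd (proj₁ y) d a (pow-ord≡1 y) ⟩
        1#                      ∎
      b≢0 : b ≢ 0
      b≢0 e = 0≢1+n (sym (trans d≡bg (cong (ℕ._* g) e)))
      b*g≤b*1 : b ℕ.* g ≤ b ℕ.* 1
      b*g≤b*1 = subst₂ _≤_ d≡bg (sym (NP.*-identityʳ b))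
        (∣⇒≤ {{≢-nonZero b≢0}} (subst (_∣ b) ordx≡d (ord∣ x b x^b≡1)))
      g≢0 : g ≢ 0
      g≢0 e = 0≢1+n (sym (gcd[m,n]≡0⇒n≡0 k e))
      g≡1 : g ≡ 1
      g≡1 = NP.≤-antisym (NP.*-cancelˡ-≤ b {{≢-nonZero b≢0}} b*g≤b*1) (NP.n≢0⇒n>0 g≢0)

    #OfOrder≤φ-inhabited : ∀ i (y : OfOrder i) → #OfOrder i ≤ φ (suc (toℕ i))
    #OfOrder≤φ-inhabited i (y , ty) = subst (λ z → #OfOrder i ≤ φ z) (ord-OfOrder i (y , ty))
        (card-injection-≤ (card-OfOrder i) (card-φ d) f finj)
      where
      d : ℕ
      d = ord y
      ordx≡d : ∀ (x : OfOrder i) → ord (proj₁ x) ≡ d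
      ordx≡d x = trans (ord-OfOrder i x) (sym (ord-OfOrder i (y , ty)))
      x^d≡1 : ∀ (x : OfOrder i) → pow (proj₁ (proj₁ x)) d ≡ 1#
      x^d≡1 x = subst (λ z → pow (proj₁ (proj₁ x)) z ≡ 1#) (ordx≡d x) (pow-ord≡1 (proj₁ x))
      exponent : OfOrder i → Fin d
      exponent x = proj₁ (all-powers y (proj₁ (proj₁ x)) (x^d≡1 x))
      exponent-eq : ∀ x → pow (proj₁ y) (suc (toℕ (exponent x))) ≡ proj₁ (proj₁ x)
      exponent-eq x = proj₂ (all-powers y (proj₁ (proj₁ x)) (x^d≡1 x))
      f : OfOrder i → Sub (Fin d) (coprimeTo d)
      f x = exponent x , dec-T (coprime? _ d) (power-of-same-order⇒coprime y (proj₁ x) _ (exponent-eq x) (ordx≡d x))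
      finj : ∀ {x x'} → f x ≡ f x' → x ≡ x'
      finj {x@((a , t) , u)} {x'@((a' , t') , u')} e = Sub-≡ {A = Nonzero} {b = hasOrder i} {t = u} {t' = u'}
          (Sub-≡ {A = Carrier} {b = isNonzero} {t = t} {t' = t'} a≡a')
        where
        a≡a' : a ≡ a'
        a≡a' = trans (sym (exponent-eq x)) (trans (cong (λ j → pow (proj₁ y) (suc (toℕ j))) (cong proj₁ e)) (exponent-eq x'))

    #OfOrder≤φ∣ : ∀ i → #OfOrder i ≤ φ∣ i
    #OfOrder≤φ∣ i with suc (toℕ i) ∣? n
    ... | no ¬dv = NP.≤-reflexive (card-unique (card-OfOrder i) (card-empty (λ x → ¬dv (subst (_∣ n) (ord-OfOrder i x) (ord∣n (proj₁ x))))))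
    ... | yes dv = card≤φ (#OfOrder i) (card-OfOrder i)
      where
      card≤φ : ∀ c → Card (OfOrder i) c → c ≤ φ (suc (toℕ i))
      card≤φ zero _ = z≤n
      card≤φ (suc k) cc = subst (_≤ φ (suc (toℕ i))) (card-unique (card-OfOrder i) cc) (#OfOrder≤φ-inhabited i (card-inhabited cc))

    card-positive : ∀ {A : Set} c → Card A c → A → 1 ≤ c
    card-positive zero e a with Inverse.from e a
    ... | ()
    card-positive (suc c) e a = s≤s z≤n

    lastOrder : Fin n
    lastOrder = fromℕ n'

    φ∣-last-positive : 1 ≤ φ∣ lastOrder
    φ∣-last-positive with suc (toℕ lastOrder) ∣? n
    ... | no ¬p = ⊥-elim (¬p (subst (_∣ n) (sym (cong suc (toℕ-fromℕ n'))) ∣-refl))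
    ... | yes _ = card-positive _ (card-φ (suc (toℕ lastOrder))) (zero , dec-T (coprime? 1 (suc (toℕ lastOrder)))
        (gcd≡1⇒coprime (gcd-zeroˡ (suc (toℕ lastOrder)))))

    abstract
      primitiveElement : Σ Nonzero (λ g → ord g ≡ n)
      primitiveElement = ofLastOrder (#OfOrder lastOrder) (card-OfOrder lastOrder) refl
        where
        ofLastOrder : ∀ c → Card (OfOrder lastOrder) c → c ≡ #OfOrder lastOrder → Σ Nonzero (λ g → ord g ≡ n)
        ofLastOrder zero _ e = ⊥-elim (NP.<-irrefl refl (subst₂ _<_ sum-#OfOrder sum-φ∣
          (sumFin-strict n #OfOrder φ∣ #OfOrder≤φ∣ lastOrder (subst (_< φ∣ lastOrder) e φ∣-last-positive))))
        ofLastOrder (suc k) cc _ = let x = card-inhabited cc in proj₁ x , trans (ord-OfOrder lastOrder x) (cong suc (toℕ-fromℕ n'))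


module DiscreteLogarithm where

  open Cardinality
  open DistinctVectors
  open FieldArithmetic
  open PrimitiveElement
  open CyclicShift
  open import Defs using (FiniteField)
  open import Data.Nat as ℕ using (ℕ; zero; suc; _<_)
  import Data.Nat.Properties as NP
  open import Data.Nat.DivMod using (_%_; _/_; m≡m%n+[m/n]*n)
  open import Data.Fin using (Fin; zero; suc; toℕ)
  open import Data.Fin.Properties using (toℕ<n; toℕ-injective; any?)
  open import Data.Empty using (⊥-elim)
  open import Data.Product using (∃; _,_; proj₁; proj₂)
  open import Function.Bundles using (Inverse)
  open import Relation.Nullary using (Dec; yes; no)
  open import Relation.Binary.PropositionalEquality

  module Logarithm (n' : ℕ) (F : FiniteField (suc (suc n'))) where
    open Field n' F
    open OrderCount n' F using (primitiveElement)
    open Shift n' using (_⊕_; toℕ-⊕)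
    open ≡-Reasoning

    generator : Nonzero
    generator = proj₁ primitiveElement
    g : Carrier
    g = proj₁ generator
    ord-generator : ord generator ≡ n
    ord-generator = proj₂ primitiveElement

    generator^n : pow g n ≡ 1#
    generator^n = subst (λ z → pow g z ≡ 1#) ord-generator (pow-ord≡1 generator)

    g≢0 : g ≢ 0#
    g≢0 = nonzero-value generator

    exp : Fin n → Carrier
    exp a = pow g (toℕ a)

    exp-nonzero : ∀ a → exp a ≢ 0#
    exp-nonzero a = pow-nz (toℕ a) g≢0

    exp-injective : ∀ {a b} → exp a ≡ exp b → a ≡ b
    exp-injective {a} {b} e = toℕ-injective (pow-distinct generator (toℕ a) (toℕ b)
       (subst (toℕ a <_) (sym ord-generator) (toℕ<n a)) (subst (toℕ b <_) (sym ord-generator) (toℕ<n b)) e)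

    pow-% : ∀ t → pow g t ≡ pow g (t % n)
    pow-% t = begin
        pow g t
      ≡⟨ cong (pow g) (m≡m%n+[m/n]*n t n) ⟩
        pow g (t % n ℕ.+ t / n ℕ.* n)
      ≡⟨ pow-+ g (t % n) _ ⟩
        pow g (t % n) * pow g (t / n ℕ.* n)
      ≡⟨ cong (pow g (t % n) *_) (pow-dvd g n (t / n) generator^n) ⟩
        pow g (t % n) * 1#
      ≡⟨ *-identityʳ _ ⟩
        pow g (t % n) ∎

    exp-⊕ : ∀ a s → exp (a ⊕ s) ≡ exp a * pow g s
    exp-⊕ a s = begin
        pow g (toℕ (a ⊕ s))
      ≡⟨ cong (pow g) (toℕ-⊕ a s) ⟩
        pow g ((toℕ a ℕ.+ s) % n)
      ≡⟨ sym (pow-% (toℕ a ℕ.+ s)) ⟩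
        pow g (toℕ a ℕ.+ s)
      ≡⟨ pow-+ g (toℕ a) s ⟩
        exp a * pow g s ∎

    exp-surjective : ∀ x → x ≢ 0# → ∃ λ a → exp a ≡ x
    exp-surjective x hx = a , cong proj₁ (trans (sym (Inverse.strictlyInverseˡ card-Nonzero (exp a , nonzero⇒T (exp-nonzero a))))
                            (trans (cong (Inverse.to card-Nonzero) ea) (Inverse.strictlyInverseˡ card-Nonzero (x , nonzero⇒T hx))))
      where
      h : Fin n → Fin n
      h a = Inverse.from card-Nonzero (exp a , nonzero⇒T (exp-nonzero a))
      hinj : ∀ {a b} → h a ≡ h b → a ≡ b
      hinj {a} {b} eq = exp-injective (cong proj₁ (Inverse-to-injective (↔-sym' card-Nonzero) {exp a , nonzero⇒T
          (exp-nonzero a)} {exp b , nonzero⇒T (exp-nonzero b)} eq))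
        where
        open import Function.Properties.Inverse using () renaming (↔-sym to ↔-sym')
      r = injective⇒surjective h hinj (Inverse.from card-Nonzero (x , nonzero⇒T hx))
      a : Fin n
      a = proj₁ r
      ea : h a ≡ Inverse.from card-Nonzero (x , nonzero⇒T hx)
      ea = proj₂ r

    abstract
      log-search : ∀ x → Dec (∃ λ a → exp a ≡ x) → Fin n
      log-search x (yes p) = proj₁ p
      log-search x (no _) = zero

      log : Carrier → Fin n
      log x = log-search x (any? (λ a → exp a ≟ x))

      exp-log-search : ∀ x → x ≢ 0# → (d : Dec (∃ λ a → exp a ≡ x)) → exp (log-search x d) ≡ x
      exp-log-search x hx (yes p) = proj₂ p
      exp-log-search x hx (no ¬p) = ⊥-elim (¬p (exp-surjective x hx))

      exp-log : ∀ x → x ≢ 0# → exp (log x) ≡ x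
      exp-log x hx = exp-log-search x hx (any? (λ a → exp a ≟ x))

    log-exp : ∀ a → log (exp a) ≡ a
    log-exp a = exp-injective (exp-log (exp a) (exp-nonzero a))


module Eigenpairs where

  open Cardinality
  open DistinctVectors
  open Enumeration
  open FieldArithmetic
  open PrimitiveElement
  open DiscreteLogarithm
  open CyclicShift
  open ShiftClosedCount
  open DivisorSum
  open import Defs
  open import Data.Nat as ℕ using (ℕ; zero; suc; _!; _/_)
  open import Data.Nat.GCD using (gcd)
  open import Data.Nat.Combinatorics using (_C_)
  open import Data.Fin using (Fin; zero; suc; toℕ)
  open import Data.Fin.Properties using (all?; any?) renaming (_≟_ to _≟F_)
  open import Data.Bool using (Bool; T; _∧_)
  open import Data.Product using (Σ; _×_; _,_; proj₁; proj₂)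
  open import Data.Vec using (Vec; lookup; map; tabulate)
  open import Data.Vec.Properties using (lookup-map; lookup∘tabulate; tabulate∘lookup; tabulate-cong)
  open import Function.Bundles using (Inverse; _↔_; mk↔ₛ′)
  open import Function.Properties.Inverse using (↔-sym; ↔-trans)
  open import Relation.Nullary using (Dec)
  open import Relation.Nullary.Decidable using (⌊_⌋; T?; map′; _×-dec_; ¬?)
  open import Relation.Binary.PropositionalEquality

  -- i0 witnesses m ≥ 1: the eigenvalue is read off at the nonzero entry x i0, which makes it unique.
  module Correspondence (n' : ℕ) (F : FiniteField (suc (suc n'))) (m : ℕ) (i0 : Fin m) where
    open Field n' F
    open Logarithm n' F
    open Shift n' using (_⊕_; ShiftClosed; shiftClosed?)
    open ShiftClosedVectors n' m using (DistinctShiftClosed; countForGcd; card-distinctShiftClosed)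
    open RightHandSide n' m using (sum-countForGcd≡rhs)
    module CarrierVec = VecMembership _≟_
    module ExponentVec = VecMembership (_≟F_ {n})
    module PositionVec = VecMembership (_≟F_ {m})

    Candidate : Set
    Candidate = Vec (Fin m) m × Vec Carrier m

    isPerm? : (σ : Vec (Fin m) m) → Dec (IsPerm σ)
    isPerm? σ = map′ (PositionVec.distinct⇒injective σ) (PositionVec.injective⇒distinct σ) (T? (PositionVec.distinct σ))

    nonzero? : (x : Vec Carrier m) → Dec (∀ i → lookup x i ≢ 0#)
    nonzero? x = all? (λ i → ¬? (lookup x i ≟ 0#))

    injective? : (x : Vec Carrier m) → Dec (∀ {i j} → lookup x i ≡ lookup x j → i ≡ j)
    injective? x = map′ (CarrierVec.distinct⇒injective x) (CarrierVec.injective⇒distinct x) (T? (CarrierVec.distinct x))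

    EigenvalueFor : Vec (Fin m) m → Vec Carrier m → Carrier → Set
    EigenvalueFor σ x l = l ≢ 0# × (∀ i → permAct F σ x i ≡ l * lookup x i)

    eigenvalueFor? : ∀ σ x l → Dec (EigenvalueFor σ x l)
    eigenvalueFor? σ x l = ¬? (l ≟ 0#) ×-dec all? (λ i → permAct F σ x i ≟ (l * lookup x i))

    eigenvalue? : ∀ σ x → Dec (Σ Carrier (EigenvalueFor σ x))
    eigenvalue? σ x = map′ (λ p → Inverse.to enum (proj₁ p) , proj₂ p)
                    (λ p → Inverse.from enum (proj₁ p) , subst (EigenvalueFor σ x) (sym (Inverse.strictlyInverseˡ enum (proj₁ p))) (proj₂ p))
                    (any? (λ a → eigenvalueFor? σ x (Inverse.to enum a)))

    inEstar? : ∀ (p : Candidate) → Dec (PairInEstar F p)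
    inEstar? (σ , x) = isPerm? σ ×-dec (nonzero? x ×-dec (injective? x ×-dec eigenvalue? σ x))

    isInEstar : Candidate → Bool
    isInEstar p = ⌊ inEstar? p ⌋

    isShiftPair : Fin n × Vec (Fin n) m → Bool
    isShiftPair kv = ExponentVec.distinct (proj₂ kv) ∧ ⌊ shiftClosed? (toℕ (proj₁ kv)) (proj₂ kv) ⌋

    EstarPair : Set
    EstarPair = Sub Candidate isInEstar

    module _ (s : EstarPair) where
      inEstar : PairInEstar F (proj₁ s)
      inEstar = T-dec (inEstar? (proj₁ s)) (proj₂ s)
      perm-of : Vec (Fin m) m
      perm-of = proj₁ (proj₁ s)
      vector-of : Vec Carrier m
      vector-of = proj₂ (proj₁ s)
      vector-nonzero : ∀ i → lookup vector-of i ≢ 0#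
      vector-nonzero = proj₁ (proj₂ inEstar)
      vector-injective : ∀ {i j} → lookup vector-of i ≡ lookup vector-of j → i ≡ j
      vector-injective = proj₁ (proj₂ (proj₂ inEstar))
      eigenvalue-of : Carrier
      eigenvalue-of = proj₁ (proj₂ (proj₂ (proj₂ inEstar)))
      eigenvalue-nonzero : eigenvalue-of ≢ 0#
      eigenvalue-nonzero = proj₁ (proj₂ (proj₂ (proj₂ (proj₂ inEstar))))
      eigen-equation : ∀ i → lookup vector-of (lookup perm-of i) ≡ eigenvalue-of * lookup vector-of i
      eigen-equation = proj₂ (proj₂ (proj₂ (proj₂ (proj₂ inEstar))))
      shift-of : Fin n
      shift-of = log eigenvalue-of
      logVector : Vec (Fin n) m
      logVector = map log vector-of

      exp-logVector : ∀ i → exp (lookup logVector i) ≡ lookup vector-of i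
      exp-logVector i = trans (cong exp (lookup-map i log vector-of)) (exp-log _ (vector-nonzero i))

      logVector-shift : ∀ i → lookup logVector (lookup perm-of i) ≡ lookup logVector i ⊕ toℕ shift-of
      logVector-shift i = exp-injective (begin
          exp (lookup logVector (lookup perm-of i))
        ≡⟨ exp-logVector (lookup perm-of i) ⟩
          lookup vector-of (lookup perm-of i)
        ≡⟨ eigen-equation i ⟩
          eigenvalue-of * lookup vector-of i
        ≡⟨ *-comm eigenvalue-of _ ⟩
          lookup vector-of i * eigenvalue-of
        ≡⟨ cong₂ _*_ (sym (exp-logVector i)) (sym (exp-log eigenvalue-of eigenvalue-nonzero)) ⟩
          exp (lookup logVector i) * exp shift-of
        ≡⟨ sym (exp-⊕ (lookup logVector i) (toℕ shift-of)) ⟩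
          exp (lookup logVector i ⊕ toℕ shift-of) ∎)
        where open ≡-Reasoning

      logVector-distinct : T (ExponentVec.distinct logVector)
      logVector-distinct = ExponentVec.injective⇒distinct logVector (λ {i} {j} e → vector-injective (trans (sym
          (exp-logVector i)) (trans (cong exp e) (exp-logVector j))))

      logVector-shiftClosed : ShiftClosed (toℕ shift-of) logVector
      logVector-shiftClosed i = ExponentVec.member-complete _ logVector (lookup perm-of i) (logVector-shift i)

    toShiftPair : EstarPair → Fin n × Vec (Fin n) m
    toShiftPair s = shift-of s , logVector s

    toShiftPair-valid : ∀ s → T (isShiftPair (toShiftPair s))
    toShiftPair-valid s = ∧T (logVector-distinct s) (dec-T (shiftClosed? (toℕ (shift-of s)) (logVector s)) (logVector-shiftClosed s))

    Vec-ext : ∀ {A : Set} {k} (u w : Vec A k) → (∀ i → lookup u i ≡ lookup w i) → u ≡ w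
    Vec-ext u w h = trans (sym (tabulate∘lookup u)) (trans (tabulate-cong h) (tabulate∘lookup w))

    ShiftPair : Set
    ShiftPair = Sub (Fin n × Vec (Fin n) m) isShiftPair

    module _ (s : ShiftPair) where
      shift : Fin n
      shift = proj₁ (proj₁ s)
      exponents : Vec (Fin n) m
      exponents = proj₂ (proj₁ s)
      exponents-distinct : T (ExponentVec.distinct exponents)
      exponents-distinct = proj₁ (T∧ (proj₂ s))
      exponents-shiftClosed : ShiftClosed (toℕ shift) exponents
      exponents-shiftClosed = T-dec (shiftClosed? (toℕ shift) exponents) (proj₂ (T∧ {ExponentVec.distinct exponents} (proj₂ s)))
      shiftPosition : Fin m → Fin m
      shiftPosition i = proj₁ (ExponentVec.member-sound (lookup exponents i ⊕ toℕ shift) exponents (exponents-shiftClosed i))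
      shiftPosition-eq : ∀ i → lookup exponents (shiftPosition i) ≡ lookup exponents i ⊕ toℕ shift
      shiftPosition-eq i = proj₂ (ExponentVec.member-sound (lookup exponents i ⊕ toℕ shift) exponents (exponents-shiftClosed i))
      shiftPerm : Vec (Fin m) m
      shiftPerm = tabulate shiftPosition
      expVector : Vec Carrier m
      expVector = map exp exponents
      lookup-expVector : ∀ i → lookup expVector i ≡ exp (lookup exponents i)
      lookup-expVector i = lookup-map i exp exponents
      eigen-fromShiftPair : ∀ i → permAct F shiftPerm expVector i ≡ exp shift * lookup expVector i
      eigen-fromShiftPair i = begin
          lookup expVector (lookup shiftPerm i)
        ≡⟨ cong (lookup expVector) (lookup∘tabulate shiftPosition i) ⟩
          lookup expVector (shiftPosition i)
        ≡⟨ lookup-expVector (shiftPosition i) ⟩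
          exp (lookup exponents (shiftPosition i))
        ≡⟨ cong exp (shiftPosition-eq i) ⟩
          exp (lookup exponents i ⊕ toℕ shift)
        ≡⟨ exp-⊕ (lookup exponents i) (toℕ shift) ⟩
          exp (lookup exponents i) * exp shift
        ≡⟨ *-comm _ _ ⟩
          exp shift * exp (lookup exponents i)
        ≡⟨ cong (exp shift *_) (sym (lookup-expVector i)) ⟩
          exp shift * lookup expVector i ∎
        where open ≡-Reasoning
      isPerm-fromShiftPair : IsPerm shiftPerm
      isPerm-fromShiftPair {i} {j} e = ExponentVec.distinct⇒injective exponents exponents-distinct (exp-injective
          (cancelʳ (pow-nz (toℕ shift) g≢0) scaled-eq))
        where
        positions-eq : shiftPosition i ≡ shiftPosition j
        positions-eq = trans (sym (lookup∘tabulate shiftPosition i)) (trans e (lookup∘tabulate shiftPosition j))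
        shifted-eq : lookup exponents i ⊕ toℕ shift ≡ lookup exponents j ⊕ toℕ shift
        shifted-eq = trans (sym (shiftPosition-eq i)) (trans (cong (lookup exponents) positions-eq) (shiftPosition-eq j))
        scaled-eq : exp (lookup exponents i) * pow g (toℕ shift) ≡ exp (lookup exponents j) * pow g (toℕ shift)
        scaled-eq = trans (sym (exp-⊕ (lookup exponents i) (toℕ shift))) (trans (cong exp shifted-eq) (exp-⊕ (lookup exponents j) (toℕ shift)))
      inEstar-fromShiftPair : PairInEstar F (shiftPerm , expVector)
      inEstar-fromShiftPair = isPerm-fromShiftPair , (λ i e → exp-nonzero (lookup exponents i) (trans (sym (lookup-expVector i)) e)) ,
           (λ {i} {j} e → ExponentVec.distinct⇒injective exponents exponents-distinct (exp-injective (trans (sym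
               (lookup-expVector i)) (trans e (lookup-expVector j))))) ,
           (exp shift , exp-nonzero shift , eigen-fromShiftPair)

    fromShiftPair : ShiftPair → Candidate
    fromShiftPair s = shiftPerm s , expVector s

    fromShiftPair-valid : ∀ s → T (isInEstar (fromShiftPair s))
    fromShiftPair-valid s = dec-T (inEstar? (fromShiftPair s)) (inEstar-fromShiftPair s)

    toShiftPair-fromShiftPair : ∀ s → toShiftPair (fromShiftPair s , fromShiftPair-valid s) ≡ proj₁ s
    toShiftPair-fromShiftPair s = cong₂ _,_ shift-eq exponents-eq
      where
      s' : EstarPair
      s' = fromShiftPair s , fromShiftPair-valid s
      exponents-eq : logVector s' ≡ exponents s
      exponents-eq = Vec-ext _ _ (λ i → trans (lookup-map i log (expVector s)) (trans (cong log
          (lookup-expVector s i)) (log-exp (lookup (exponents s) i))))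
      entry-nonzero : lookup (expVector s) i0 ≢ 0#
      entry-nonzero e = exp-nonzero (lookup (exponents s) i0) (trans (sym (lookup-expVector s i0)) e)
      eigenvalue-eq : eigenvalue-of s' ≡ exp (shift s)
      eigenvalue-eq = cancelʳ entry-nonzero (trans (sym (eigen-equation s' i0)) (eigen-fromShiftPair s i0))
      shift-eq : shift-of s' ≡ shift s
      shift-eq = trans (cong log eigenvalue-eq) (log-exp (shift s))

    fromShiftPair-toShiftPair : ∀ s → fromShiftPair (toShiftPair s , toShiftPair-valid s) ≡ proj₁ s
    fromShiftPair-toShiftPair s = cong₂ _,_ perm-eq vector-eq
      where
      s'' : ShiftPair
      s'' = toShiftPair s , toShiftPair-valid s
      vector-eq : expVector s'' ≡ vector-of s
      vector-eq = Vec-ext _ _ (λ i → trans (lookup-expVector s'' i) (exp-logVector s i))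
      perm-eq : shiftPerm s'' ≡ perm-of s
      perm-eq = Vec-ext _ _ (λ i → trans (lookup∘tabulate (shiftPosition s'') i)
             (ExponentVec.distinct⇒injective (logVector s) (logVector-distinct s) (trans (shiftPosition-eq s'' i) (sym (logVector-shift s i)))))

    EstarPair↔ShiftPair : EstarPair ↔ ShiftPair
    EstarPair↔ShiftPair = Sub-↔-mk isInEstar isShiftPair toShiftPair fromShiftPair toShiftPair-valid fromShiftPair-valid toShiftPair-fromShiftPair fromShiftPair-toShiftPair

    Σ↔ShiftPair : Σ (Fin n) (λ k → DistinctShiftClosed (toℕ k)) ↔ ShiftPair
    Σ↔ShiftPair = mk↔ₛ′ (λ { (k , v , t) → (k , v) , t }) (λ { ((k , v) , t) → k , v , t }) (λ _ → refl) (λ _ → refl)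

    card-EstarPair : Card EstarPair (m ! ℕ.* sumDivisors (gcd n m) (λ d → φ d ℕ.* ((n / d) C (m / d))))
    card-EstarPair = subst (Card EstarPair) sum-countForGcd≡rhs
      (card-resp (↔-trans Σ↔ShiftPair (↔-sym EstarPair↔ShiftPair)) (card-ΣFin n (λ k → DistinctShiftClosed
          (toℕ k)) (λ k → countForGcd (gcd (toℕ k) n)) (λ k → card-distinctShiftClosed (toℕ k))))


open Cardinality
open Enumeration
open Eigenpairs

no-field-of-size-0 : ¬ FiniteField 0
no-field-of-size-0 F with Inverse.from (FiniteField.enum F) (FiniteField.0# F)
... | ()

no-field-of-size-1 : ¬ FiniteField 1
no-field-of-size-1 F = FiniteField.0≢1 F (Inverse-to-injective (↔-sym enum) (Fin1-irrelevant (from 0#) (from 1#)))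
  where
  open FiniteField F
  from : Carrier → Fin 1
  from = Inverse.from enum
  Fin1-irrelevant : (a b : Fin 1) → a ≡ b
  Fin1-irrelevant zero zero = refl

allPairs-enumerates : ∀ {q} (F : FiniteField q) m → Enumerates _ (allPairs F m)
allPairs-enumerates {q} F m = enum-cart {xs = allMaps m} {ys = allVecs (elems F) m}
  (enum-allVecs {xs = allFin m} (enum-allFin m) m)
  (enum-allVecs {xs = elems F} (enum-map {xs = allFin q} (enum-allFin q) (FiniteField.enum F)) m)

lemma5 : (q : ℕ) (F : FiniteField q) (m : ℕ) → m ≥ 1 →
    CountIn (PairInEstar F) (allPairs F m) (rhs q m)
lemma5 zero F m _ = ⊥-elim (no-field-of-size-0 F)
lemma5 (suc zero) F m _ = ⊥-elim (no-field-of-size-1 F)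
lemma5 (suc (suc n')) F (suc m') _ =
  countIn-card (inEstar? (suc m') zero) (allPairs F (suc m')) (allPairs-enumerates F (suc m')) (card-EstarPair (suc m') zero)
  where open Correspondence n' F
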